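{- Let $\mathbb{F}_q$ be a finite field, let $r\le d$ be positive integers, let $X_1,\ldots,X_r$ be indeterminates, let $\Pi_1,\ldots,\Pi_r$ be the elementary symmetric polynomials of $\mathbb{F}_q[X_1,\ldots,X_r]$, and $Q:=(T-X_1)\cdots(T-X_r)$. For $r\le j\le d$, write $$T^j\equiv H_{r-1,j}T^{r-1}+H_{r-2,j}T^{r-2}+\cdots+H_{0,j}\pmod Q$$ with $H_{i,j}\in\mathbb{F}_q[X_1,\ldots,X_r]$ (the remainder of $T^j$ upon division by $Q$ in $\mathbb{F}_q[X_1,\ldots,X_r][T]$). Then each $H_{i,j}$ is either zero or a homogeneous element of $\mathbb{F}_q[X_1,\ldots,X_r]$ of degree $j-i$. Furthermore, for $j-i\le r$, the polynomial $H_{i,j}$ is, up to a nonzero constant of $\mathbb{F}_q$, a monic element of $\mathbb{F}_q[\Pi_1,\ldots,\Pi_{j-i-1}][\Pi_{j-i}]$.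
   Context: Monic element of $\mathbb{F}_q[\Pi_1,\ldots,\Pi_{k-1}][\Pi_k]$ means a polynomial in $\Pi_k$ with coefficients in $\mathbb{F}_q[\Pi_1,\ldots,\Pi_{k-1}]$ whose leading coefficient is $1$. -}

module Defs where

open import Level using (Level; _⊔_) renaming (suc to lsuc)
open import Data.Nat as ℕ using (ℕ; zero; suc; _<_; _≤_; _≟_)
open import Data.Fin using (Fin; toℕ)
open import Data.Vec as Vec using (Vec; []; _∷_; replicate; _∷ʳ_; allFin)
open import Data.Vec.Properties using (≡-dec)
open import Data.List as List using (List; []; _∷_; _++_; concatMap; upTo)
open import Data.Product using (Σ; ∃; _×_; _,_)
open import Relation.Nullary using (¬_; yes; no)
open import Relation.Binary.PropositionalEquality using (_≡_)
open import Algebra.Bundles using (CommutativeRing)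

record FiniteField (c ℓ : Level) : Set (lsuc (c ⊔ ℓ)) where
  field
    commRing : CommutativeRing c ℓ
  open CommutativeRing commRing public
  field
    1≉0     : ¬ (1# ≈ 0#)
    inverse : ∀ x → ¬ (x ≈ 0#) → Σ Carrier (λ y → (x * y) ≈ 1#)
    q       : ℕ
    enum    : Fin q → Carrier
    enum-onto : ∀ x → Σ (Fin q) (λ k → enum k ≈ x)

-- Bare ring operations (no laws are needed to *state* things)

record RingOps (c ℓ : Level) : Set (lsuc (c ⊔ ℓ)) where
  infixl 6 _+_ _-_
  infixl 7 _*_
  infix  4 _≈_
  field
    Carrier : Set c
    _≈_     : Carrier → Carrier → Set ℓ
    0# 1#   : Carrier
    _+_ _*_ : Carrier → Carrier → Carrier
    -_      : Carrier → Carrier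
  _-_ : Carrier → Carrier → Carrier
  x - y = x + (- y)

ringOps : ∀ {c ℓ} → CommutativeRing c ℓ → RingOps c ℓ
ringOps R = record
  { Carrier = Carrier ; _≈_ = _≈_ ; 0# = 0# ; 1# = 1#
  ; _+_ = _+_ ; _*_ = _*_ ; -_ = -_ }
  where open CommutativeRing R

deg : ∀ {n} → Vec ℕ n → ℕ
deg = Vec.sum

splits : ∀ {n} → Vec ℕ n → List (Vec ℕ n × Vec ℕ n)
splits [] = ([] , []) ∷ []
splits (e ∷ es) =
  concatMap (λ a → List.map (λ { (as , bs) → (a ∷ as , (e ℕ.∸ a) ∷ bs) }) (splits es))
            (upTo (suc e))

box : ℕ → (n : ℕ) → List (Vec ℕ n)
box N zero = [] ∷ []
box N (suc n) = concatMap (λ a → List.map (a ∷_) (box N n)) (upTo (suc N))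


-- Polynomial rings A[Y₁,…,Yₙ] over a ring A (coefficient functions on
-- exponent vectors; polynomials are those with finite support, see IsPoly)

module _ {c ℓ} (A : RingOps c ℓ) where
  open RingOps A

  sumA : List Carrier → Carrier
  sumA = List.foldr _+_ 0#

  prodA : List Carrier → Carrier
  prodA = List.foldr _*_ 1#

  powA : Carrier → ℕ → Carrier
  powA x zero = 1#
  powA x (suc m) = x * powA x m

  Poly : ℕ → RingOps c ℓ
  Poly n = record
    { Carrier = Vec ℕ n → Carrier
    ; _≈_ = λ f g → ∀ e → f e ≈ g e
    ; 0# = λ _ → 0#
    ; 1# = λ e → if0 e
    ; _+_ = λ f g e → f e + g e
    ; _*_ = λ f g e → sumA (List.map (λ { (a , b) → f a * g b }) (splits e))
    ; -_ = λ f e → - f e }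
    where
    if0 : Vec ℕ n → Carrier
    if0 e with ≡-dec _≟_ e (replicate n 0)
    ... | yes _ = 1#
    ... | no  _ = 0#

  IsPolyBound : ∀ {n} → ℕ → (Vec ℕ n → Carrier) → Set ℓ
  IsPolyBound N f = ∀ e → N < deg e → f e ≈ 0#

  IsPoly : ∀ {n} → (Vec ℕ n → Carrier) → Set ℓ
  IsPoly f = ∃ λ N → IsPolyBound N f

  const : ∀ {n} → Carrier → Vec ℕ n → Carrier
  const {n} a e with ≡-dec _≟_ e (replicate n 0)
  ... | yes _ = a
  ... | no  _ = 0#

  var : ∀ {n} → Fin n → Vec ℕ n → Carrier
  var {n} k e with ≡-dec _≟_ e (Vec.updateAt (replicate n 0) k (λ _ → 1))
  ... | yes _ = 1#
  ... | no  _ = 0#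

  IsHomogeneous : ∀ {n} → ℕ → (Vec ℕ n → Carrier) → Set ℓ
  IsHomogeneous m f = ∀ e → ¬ (deg e ≡ m) → f e ≈ 0#

  -- evaluation of a polynomial P with support bound N at a point v ∈ Bⁿ,
  -- B an A-algebra given by the structure map ι
  module _ {c' ℓ'} (B : RingOps c' ℓ') (ι : Carrier → RingOps.Carrier B) where
    private module B = RingOps B
    eval : ∀ {n} → ℕ → (Vec ℕ n → Carrier) → (Fin n → B.Carrier) → B.Carrier
    eval {n} N P v =
      List.foldr B._+_ B.0#
        (List.map (λ e → ι (P e) B.* monomial e) (box N n))
      where
      monomial : Vec ℕ n → B.Carrier
      monomial e = List.foldr B._*_ B.1#
        (Vec.toList (Vec.zipWith (λ x m → powB x m) (Vec.tabulate v) e))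
        where
        powB : B.Carrier → ℕ → B.Carrier
        powB x zero = B.1#
        powB x (suc m) = x B.* powB x m

  -- P ∈ A[Y₁,…,Y_{k}][Y_{k+1}] is monic in the last variable Y_{k+1}:
  -- for some m the coefficient of Y_{k+1}^m (an element of A[Y₁,…,Y_k])
  -- is the constant 1, and all coefficients of higher powers vanish.
  IsMonicLast : ∀ {k} → (Vec ℕ (suc k) → Carrier) → Set ℓ
  IsMonicLast {k} P = Σ ℕ λ m →
      (P (replicate k 0 ∷ʳ m) ≈ 1#)
    × (∀ rest → ¬ (rest ≡ replicate k 0) → P (rest ∷ʳ m) ≈ 0#)
    × (∀ m' rest → m < m' → P (rest ∷ʳ m') ≈ 0#)

module Setting {c ℓ} (F : FiniteField c ℓ) (r : ℕ) where
  Fo : RingOps c ℓ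
  Fo = ringOps (FiniteField.commRing F)

  R : RingOps c ℓ
  R = Poly Fo r

  RT : RingOps c ℓ
  RT = Poly R 1

  open RingOps Fo using () renaming (Carrier to K; 0# to 0F; 1# to 1F)

  -- elementary symmetric polynomial Π_k ∈ F[X₁,…,X_r]:
  -- coefficient 1 on squarefree monomials of degree k, 0 elsewhere
  esymCoeff : ∀ {n} → ℕ → Vec ℕ n → K
  esymCoeff zero    []              = 1F
  esymCoeff (suc k) []              = 0F
  esymCoeff k       (zero ∷ es)     = esymCoeff k es
  esymCoeff zero    (suc zero ∷ es) = 0F
  esymCoeff (suc k) (suc zero ∷ es) = esymCoeff k es
  esymCoeff k       (suc (suc _) ∷ es) = 0F

  Π : ℕ → RingOps.Carrier R
  Π k = esymCoeff k

  X : Fin r → RingOps.Carrier R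
  X = var Fo

  T : RingOps.Carrier RT
  T = var R Data.Fin.zero
    where import Data.Fin

  Q : RingOps.Carrier RT
  Q = prodA RT (Vec.toList (Vec.map (λ k → RingOps._-_ RT T (const R (X k))) (allFin r)))

  IsPolyRT : RingOps.Carrier RT → Set ℓ
  IsPolyRT S = IsPoly R S × (∀ e → IsPoly Fo (S e))

  IsRemainderCoeffs : ℕ → (Fin r → RingOps.Carrier R) → Set (c ⊔ ℓ)
  IsRemainderCoeffs j H =
      (∀ i → IsPoly Fo (H i))
    × Σ (RingOps.Carrier RT) λ S → IsPolyRT S
      × RingOps._≈_ RT (powA RT T j)
          (RingOps._+_ RT
            (sumA RT (Vec.toList (Vec.map (λ i → RingOps._*_ RT (const R (H i)) (powA RT T (toℕ i))) (allFin r))))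
            (RingOps._*_ RT Q S))

  evalΠ : ∀ {n} → ℕ → (Vec ℕ n → K) → RingOps.Carrier R
  evalΠ N P = eval Fo R (const Fo) N P (λ l → Π (suc (toℕ l)))

module Submission where

-- Write j = J + r and T^j = Σ_{i<r} H_i Tⁱ + Q·S.  By Vieta the coefficient
-- of Tᵃ in Q is (-1)^{r-a} e_{r-a}.  Comparing the coefficients of T^{b+r}
-- shows that those of S satisfy an order-r linear recursion driven by
-- e₁,…,e_r; having finite support, they are its unique solution G J b, and
-- the coefficients below r then give
--   H_n = - Σ_{a≤n} (-1)^{r-a} e_{r-a} · G J (n-a),
-- homogeneous of degree j - n.  The same recursion with variables Y_l in
-- place of e_l gives a polynomial in Y₁,…,Y_{j-n} evaluating to H_n at
-- Y_l = Π_l, whose only term containing Y_{j-n} is ±Y_{j-n} when j-n ≤ r.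

open import Defs
open import Data.Nat using (ℕ; suc; _≤_; _∸_)
open import Data.Fin using (Fin; toℕ)
open import Data.Vec using (Vec)
open import Data.Product using (Σ; _×_)
open import Data.Sum using (_⊎_)
open import Relation.Nullary using (¬_)
open import Relation.Binary.PropositionalEquality using (_≡_)

open import Level using (_⊔_)
open import Algebra using (CommutativeRing)
open import Algebra.Structures using (IsAbelianGroup; IsCommutativeRing)
open import Algebra.Morphism.Structures using (IsRingHomomorphism)
import Algebra.Properties.Ring as RingProperties
open import Data.Nat as ℕ using (zero; _<_; z≤n; s≤s; _≟_)
import Data.Nat.Properties as ℕP
open import Data.Fin as Fin using ()
import Data.Fin.Properties as FinP
open import Data.Vec as Vec using ([]; _∷_; replicate; _∷ʳ_)
open import Data.Vec.Properties using (≡-dec)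
open import Data.List as List using (List; []; _∷_; _++_; map; foldr; upTo; concatMap; length)
import Data.List.Properties as ListP
open import Data.Product using (_,_; proj₁; proj₂)
open import Data.Sum using (inj₂)
open import Data.Empty using (⊥-elim)
open import Function using (_∘_)
open import Relation.Nullary using (yes; no; Dec)
open import Relation.Binary.Definitions using (tri<; tri≈; tri>)
import Relation.Binary.PropositionalEquality as Eq
import Relation.Binary.Reasoning.Setoid as SetoidReasoning

-- The raw versions only need the operations, so
-- that they can be used while the ring laws of a polynomial ring are
-- still being established.

module RawSums {c} {C : Set c} (_⊕_ _⊗_ : C → C → C) (zero# : C) where

  Σ< : ℕ → (ℕ → C) → C
  Σ< zero    φ = zero#
  Σ< (suc n) φ = φ 0 ⊕ Σ< n (φ ∘ suc)

  conv : (ℕ → C) → (ℕ → C) → ℕ → C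
  conv f g n = Σ< (suc n) (λ a → f a ⊗ g (n ∸ a))

module Sums {c ℓ} (R : CommutativeRing c ℓ) where
  open CommutativeRing R
  open RingProperties ring using (-0#≈0#; -‿+-comm)
  open import Algebra.Properties.CommutativeSemigroup +-commutativeSemigroup
    using (interchange; x∙yz≈y∙xz)
  open SetoidReasoning setoid
  open RawSums _+_ _*_ 0# public

  Σ<-cong : ∀ n {φ ψ} → (∀ a → a < n → φ a ≈ ψ a) → Σ< n φ ≈ Σ< n ψ
  Σ<-cong zero    eq = refl
  Σ<-cong (suc n) eq = +-cong (eq 0 (s≤s z≤n)) (Σ<-cong n (λ a lt → eq (suc a) (s≤s lt)))

  Σ<-zero : ∀ n {φ} → (∀ a → a < n → φ a ≈ 0#) → Σ< n φ ≈ 0#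
  Σ<-zero zero    eq = refl
  Σ<-zero (suc n) eq =
    trans (+-cong (eq 0 (s≤s z≤n)) (Σ<-zero n (λ a lt → eq (suc a) (s≤s lt)))) (+-identityˡ 0#)

  Σ<-single : ∀ n a₀ {φ} → a₀ < n → (∀ a → a < n → ¬ a ≡ a₀ → φ a ≈ 0#) → Σ< n φ ≈ φ a₀
  Σ<-single (suc n) zero     _        others =
    trans (+-congˡ (Σ<-zero n (λ a lt → others (suc a) (s≤s lt) (λ ())))) (+-identityʳ _)
  Σ<-single (suc n) (suc a₀) (s≤s lt) others =
    trans (+-congʳ (others 0 (s≤s z≤n) (λ ())))
      (trans (+-identityˡ _) (Σ<-single n a₀ lt (λ a lt' ne → others (suc a) (s≤s lt') (ne ∘ ℕP.suc-injective))))

  Σ<-+ : ∀ n φ ψ → Σ< n (λ a → φ a + ψ a) ≈ Σ< n φ + Σ< n ψ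
  Σ<-+ zero    φ ψ = sym (+-identityˡ 0#)
  Σ<-+ (suc n) φ ψ = trans (+-congˡ (Σ<-+ n (φ ∘ suc) (ψ ∘ suc))) (interchange _ _ _ _)

  Σ<-*ˡ : ∀ n x φ → x * Σ< n φ ≈ Σ< n (λ a → x * φ a)
  Σ<-*ˡ zero    x φ = zeroʳ x
  Σ<-*ˡ (suc n) x φ = trans (distribˡ x _ _) (+-congˡ (Σ<-*ˡ n x (φ ∘ suc)))

  Σ<-neg : ∀ n φ → Σ< n (λ a → - φ a) ≈ - Σ< n φ
  Σ<-neg zero    φ = sym -0#≈0#
  Σ<-neg (suc n) φ = trans (+-congˡ (Σ<-neg n (φ ∘ suc))) (-‿+-comm _ _)

  Σ<-split : ∀ m n φ → Σ< (m ℕ.+ n) φ ≈ Σ< m φ + Σ< n (λ a → φ (m ℕ.+ a))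
  Σ<-split zero    n φ = sym (+-identityˡ _)
  Σ<-split (suc m) n φ = trans (+-congˡ (Σ<-split m n (φ ∘ suc))) (sym (+-assoc _ _ _))

  Σ<-last : ∀ n φ → Σ< (suc n) φ ≈ Σ< n φ + φ n
  Σ<-last n φ = begin
    Σ< (suc n) φ                 ≡⟨ Eq.cong (λ k → Σ< k φ) (ℕP.+-comm 1 n) ⟩
    Σ< (n ℕ.+ 1) φ               ≈⟨ Σ<-split n 1 φ ⟩
    Σ< n φ + (φ (n ℕ.+ 0) + 0#)  ≈⟨ +-congˡ (trans (+-identityʳ _) (reflexive (Eq.cong φ (ℕP.+-identityʳ n)))) ⟩
    Σ< n φ + φ n                 ∎

  δ : ℕ → ℕ → Carrier
  δ zero    zero    = 1#
  δ zero    (suc _) = 0#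
  δ (suc _) zero    = 0#
  δ (suc a) (suc b) = δ a b

  δ-diag : ∀ a → δ a a ≈ 1#
  δ-diag zero    = refl
  δ-diag (suc a) = δ-diag a

  δ-off : ∀ a b → ¬ a ≡ b → δ a b ≈ 0#
  δ-off zero    zero    ne = ⊥-elim (ne Eq.refl)
  δ-off zero    (suc b) ne = refl
  δ-off (suc a) zero    ne = refl
  δ-off (suc a) (suc b) ne = δ-off a b (ne ∘ Eq.cong suc)

  δ-+ˡ : ∀ k a b → δ (k ℕ.+ a) (k ℕ.+ b) ≡ δ a b
  δ-+ˡ zero    a b = Eq.refl
  δ-+ˡ (suc k) a b = δ-+ˡ k a b

  sumList : List Carrier → Carrier
  sumList = foldr _+_ 0#

  sumList-++ : ∀ xs ys → sumList (xs ++ ys) ≈ sumList xs + sumList ys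
  sumList-++ []       ys = sym (+-identityˡ _)
  sumList-++ (x ∷ xs) ys = trans (+-congˡ (sumList-++ xs ys)) (sym (+-assoc _ _ _))

  sumList-concatMap : ∀ {X Y : Set} (F : Y → Carrier) (G : X → List Y) (L : List X) →
    sumList (map F (concatMap G L)) ≈ sumList (map (λ x → sumList (map F (G x))) L)
  sumList-concatMap F G []      = refl
  sumList-concatMap F G (x ∷ L) = begin
    sumList (map F (G x ++ concatMap G L))         ≡⟨ Eq.cong sumList (ListP.map-++ F (G x) (concatMap G L)) ⟩
    sumList (map F (G x) ++ map F (concatMap G L)) ≈⟨ sumList-++ (map F (G x)) _ ⟩
    sumList (map F (G x)) + sumList (map F (concatMap G L))
                                                   ≈⟨ +-congˡ (sumList-concatMap F G L) ⟩
    sumList (map (λ x → sumList (map F (G x))) (x ∷ L)) ∎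

  sumList-upTo : ∀ (φ : ℕ → Carrier) n → sumList (map φ (upTo n)) ≡ Σ< n φ
  sumList-upTo φ n = Eq.trans (Eq.cong sumList (ListP.map-upTo φ n)) (go φ n)
    where
    go : ∀ (φ : ℕ → Carrier) n → sumList (List.applyUpTo φ n) ≡ Σ< n φ
    go φ zero    = Eq.refl
    go φ (suc n) = Eq.cong (φ 0 +_) (go (φ ∘ suc) n)

  sumList-cong : ∀ {X : Set} {F G : X → Carrier} L → (∀ x → F x ≈ G x) → sumList (map F L) ≈ sumList (map G L)
  sumList-cong []      h = refl
  sumList-cong (x ∷ L) h = +-cong (h x) (sumList-cong L h)

  sumList-+ : ∀ {X : Set} (F G : X → Carrier) L → sumList (map (λ x → F x + G x) L) ≈ sumList (map F L) + sumList (map G L)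
  sumList-+ F G []      = sym (+-identityˡ _)
  sumList-+ F G (x ∷ L) = trans (+-congˡ (sumList-+ F G L)) (interchange _ _ _ _)

  sumList-*ˡ : ∀ {X : Set} y (F : X → Carrier) L → sumList (map (λ x → y * F x) L) ≈ y * sumList (map F L)
  sumList-*ˡ y F []      = sym (zeroʳ y)
  sumList-*ˡ y F (x ∷ L) = trans (+-congˡ (sumList-*ˡ y F L)) (sym (distribˡ _ _ _))

  sumList-zero : ∀ {X : Set} (F : X → Carrier) L → (∀ x → F x ≈ 0#) → sumList (map F L) ≈ 0#
  sumList-zero F []      h = refl
  sumList-zero F (x ∷ L) h = trans (+-cong (h x) (sumList-zero F L h)) (+-identityˡ _)

  -- Convolution makes coefficient sequences a commutative ring; these are
  -- the laws needed to transport the ring structure to polynomials.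

  conv-cong : ∀ {f f′ g g′} → (∀ a → f a ≈ f′ a) → (∀ a → g a ≈ g′ a) → ∀ n → conv f g n ≈ conv f′ g′ n
  conv-cong ef eg n = Σ<-cong (suc n) (λ a _ → *-cong (ef a) (eg (n ∸ a)))

  conv-distribʳ : ∀ f g h n → conv (λ a → f a + g a) h n ≈ conv f h n + conv g h n
  conv-distribʳ f g h n =
    trans (Σ<-cong (suc n) (λ a _ → distribʳ (h (n ∸ a)) (f a) (g a)))
          (Σ<-+ (suc n) (λ a → f a * h (n ∸ a)) (λ a → g a * h (n ∸ a)))

  conv-scaleˡ : ∀ x f g n → conv (λ a → x * f a) g n ≈ x * conv f g n
  conv-scaleˡ x f g n =
    trans (Σ<-cong (suc n) (λ a _ → *-assoc x (f a) (g (n ∸ a)))) (sym (Σ<-*ˡ (suc n) x (λ a → f a * g (n ∸ a))))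

  conv-identityˡ : ∀ u g → u 0 ≈ 1# → (∀ a → u (suc a) ≈ 0#) → ∀ n → conv u g n ≈ g n
  conv-identityˡ u g u₀ uₛ n = begin
    u 0 * g (n ∸ 0) + Σ< n (λ a → u (suc a) * g (n ∸ suc a))
      ≈⟨ +-cong (*-congʳ u₀) (Σ<-zero n (λ a _ → trans (*-congʳ (uₛ a)) (zeroˡ _))) ⟩
    1# * g n + 0#  ≈⟨ trans (+-identityʳ _) (*-identityˡ _) ⟩
    g n            ∎

  conv-assoc : ∀ n f g h → conv (conv f g) h n ≈ conv f (conv g h) n
  conv-assoc zero f g h = +-congʳ (begin
    (f 0 * g 0 + 0#) * h 0  ≈⟨ *-congʳ (+-identityʳ _) ⟩
    (f 0 * g 0) * h 0       ≈⟨ *-assoc _ _ _ ⟩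
    f 0 * (g 0 * h 0)       ≈⟨ *-congˡ (sym (+-identityʳ _)) ⟩
    f 0 * (g 0 * h 0 + 0#)  ∎)
  conv-assoc (suc n) f g h = begin
    conv f g 0 * h (suc n) + conv (λ a → f 0 * g (suc a) + conv (f ∘ suc) g a) h n
      ≈⟨ +-cong (*-congʳ (+-identityʳ _)) (conv-distribʳ (λ a → f 0 * g (suc a)) (conv (f ∘ suc) g) h n) ⟩
    (f 0 * g 0) * h (suc n) + (conv (λ a → f 0 * g (suc a)) h n + conv (conv (f ∘ suc) g) h n)
      ≈⟨ +-cong (*-assoc _ _ _) (+-cong (conv-scaleˡ (f 0) (g ∘ suc) h n) (conv-assoc n (f ∘ suc) g h)) ⟩
    f 0 * (g 0 * h (suc n)) + (f 0 * conv (g ∘ suc) h n + conv (f ∘ suc) (conv g h) n)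
      ≈⟨ sym (+-assoc _ _ _) ⟩
    (f 0 * (g 0 * h (suc n)) + f 0 * conv (g ∘ suc) h n) + conv (f ∘ suc) (conv g h) n
      ≈⟨ +-congʳ (sym (distribˡ _ _ _)) ⟩
    f 0 * (g 0 * h (suc n) + conv (g ∘ suc) h n) + conv (f ∘ suc) (conv g h) n
      ∎

  conv-comm : ∀ n f g → conv f g n ≈ conv g f n
  conv-comm zero          f g = +-congʳ (*-comm _ _)
  conv-comm (suc zero)    f g = trans (+-congˡ (+-congʳ (*-comm (f 1) (g 0))))
    (trans (x∙yz≈y∙xz (f 0 * g 1) (g 0 * f 1) 0#) (+-congˡ (+-congʳ (*-comm (f 0) (g 1)))))
  conv-comm (suc (suc n)) f g = begin
    f 0 * g (2 ℕ.+ n) + conv (f ∘ suc) g (suc n)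
      ≈⟨ +-congˡ (conv-comm (suc n) (f ∘ suc) g) ⟩
    f 0 * g (2 ℕ.+ n) + (g 0 * f (2 ℕ.+ n) + conv (g ∘ suc) (f ∘ suc) n)
      ≈⟨ +-congˡ (+-congˡ (conv-comm n (g ∘ suc) (f ∘ suc))) ⟩
    f 0 * g (2 ℕ.+ n) + (g 0 * f (2 ℕ.+ n) + conv (f ∘ suc) (g ∘ suc) n)
      ≈⟨ x∙yz≈y∙xz _ _ _ ⟩
    g 0 * f (2 ℕ.+ n) + (f 0 * g (2 ℕ.+ n) + conv (f ∘ suc) (g ∘ suc) n)
      ≈⟨ +-congˡ (sym (conv-comm (suc n) (g ∘ suc) f)) ⟩
    g 0 * f (2 ℕ.+ n) + conv (g ∘ suc) f (suc n)
      ∎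

-- The
-- product is defined by summing over all splittings of an exponent
-- vector; splitting off the first exponent shows that the coefficient
-- of Y₁ˣ·(rest) in f·g is the convolution, in A[Y₂,…,Yₙ], of the
-- Y₁-coefficients of f and g (*-as-conv).  So the laws follow by
-- induction on n from the convolution laws.

module Polynomials {c ℓ} (A : CommutativeRing c ℓ) where
  open Sums A using (Σ<; Σ<-cong; δ; sumList; sumList-concatMap; sumList-upTo)
  module A = CommutativeRing A
  module AP = RingProperties A.ring
  open SetoidReasoning A.setoid

  Aᵒ : RingOps c ℓ
  Aᵒ = ringOps A

  module P (n : ℕ) = RingOps (Poly Aᵒ n)

  Coeffs : ℕ → Set c
  Coeffs n = Vec ℕ n → A.Carrier

  curry : ∀ {n} → Coeffs (suc n) → ℕ → Coeffs n
  curry f a es = f (a ∷ es)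

  1-at-origin : ∀ n e → e ≡ replicate n 0 → P.1# n e A.≈ A.1#
  1-at-origin n e p with ≡-dec _≟_ e (replicate n 0)
  ... | yes _ = A.refl
  ... | no ¬p = ⊥-elim (¬p p)

  1-off-origin : ∀ n e → ¬ e ≡ replicate n 0 → P.1# n e A.≈ A.0#
  1-off-origin n e ¬p with ≡-dec _≟_ e (replicate n 0)
  ... | yes p = ⊥-elim (¬p p)
  ... | no _  = A.refl

  1-head-zero : ∀ m es → P.1# (suc m) (0 ∷ es) A.≈ P.1# m es
  1-head-zero m es = by-cases (≡-dec _≟_ es (replicate m 0))
    where
    by-cases : Dec (es ≡ replicate m 0) → P.1# (suc m) (0 ∷ es) A.≈ P.1# m es
    by-cases (yes p) = A.trans (1-at-origin (suc m) (0 ∷ es) (Eq.cong (0 ∷_) p)) (A.sym (1-at-origin m es p))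
    by-cases (no ¬p) = A.trans (1-off-origin (suc m) (0 ∷ es) (¬p ∘ Eq.cong Vec.tail)) (A.sym (1-off-origin m es ¬p))

  1-head-suc : ∀ m a es → P.1# (suc m) (suc a ∷ es) A.≈ A.0#
  1-head-suc m a es = 1-off-origin (suc m) (suc a ∷ es) (λ ())

  +-isAbelianGroup : ∀ n → IsAbelianGroup (P._≈_ n) (P._+_ n) (P.0# n) (P.-_ n)
  +-isAbelianGroup n = record
    { isGroup = record
      { isMonoid = record
        { isSemigroup = record
          { isMagma = record
            { isEquivalence = record
              { refl = λ e → A.refl ; sym = λ p e → A.sym (p e) ; trans = λ p q e → A.trans (p e) (q e) }
            ; ∙-cong = λ p q e → A.+-cong (p e) (q e) }
          ; assoc = λ f g h e → A.+-assoc (f e) (g e) (h e) }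
        ; identity = (λ f e → A.+-identityˡ (f e)) , (λ f e → A.+-identityʳ (f e)) }
      ; inverse = (λ f e → A.-‿inverseˡ (f e)) , (λ f e → A.-‿inverseʳ (f e))
      ; ⁻¹-cong = λ p e → A.-‿cong (p e) }
    ; comm = λ f g e → A.+-comm (f e) (g e) }

  ΣP : ∀ m → ℕ → (ℕ → Coeffs m) → Coeffs m
  ΣP m = RawSums.Σ< (P._+_ m) (P._*_ m) (P.0# m)

  ΣP-at : ∀ m n ψ es → ΣP m n ψ es ≡ Σ< n (λ a → ψ a es)
  ΣP-at m zero    ψ es = Eq.refl
  ΣP-at m (suc n) ψ es = Eq.cong (ψ 0 es A.+_) (ΣP-at m n (ψ ∘ suc) es)

  *-as-conv : ∀ m (f g : Coeffs (suc m)) x es →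
    P._*_ (suc m) f g (x ∷ es) A.≈ RawSums.conv (P._+_ m) (P._*_ m) (P.0# m) (curry f) (curry g) x es
  *-as-conv m f g x es = begin
    sumList (map F (concatMap (λ a → map (prepend a) (splits es)) (upTo (suc x))))
      ≈⟨ sumList-concatMap F (λ a → map (prepend a) (splits es)) (upTo (suc x)) ⟩
    sumList (map (λ a → sumList (map F (map (prepend a) (splits es)))) (upTo (suc x)))
      ≡⟨ sumList-upTo _ (suc x) ⟩
    Σ< (suc x) (λ a → sumList (map F (map (prepend a) (splits es))))
      ≈⟨ Σ<-cong (suc x) (λ a _ → A.reflexive (Eq.cong sumList (Eq.sym (ListP.map-∘ {g = F} {f = prepend a} (splits es))))) ⟩
    Σ< (suc x) (λ a → P._*_ m (curry f a) (curry g (x ∸ a)) es)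
      ≡⟨ Eq.sym (ΣP-at m (suc x) (λ a → P._*_ m (curry f a) (curry g (x ∸ a))) es) ⟩
    RawSums.conv (P._+_ m) (P._*_ m) (P.0# m) (curry f) (curry g) x es ∎
    where
    F : Vec ℕ (suc m) × Vec ℕ (suc m) → A.Carrier
    F p = f (proj₁ p) A.* g (proj₂ p)
    prepend : ℕ → Vec ℕ m × Vec ℕ m → Vec ℕ (suc m) × Vec ℕ (suc m)
    prepend a p = (a ∷ proj₁ p , (x ∸ a) ∷ proj₂ p)

  isCommutativeRing : ∀ n → IsCommutativeRing (P._≈_ n) (P._+_ n) (P._*_ n) (P.-_ n) (P.0# n) (P.1# n)
  isCommutativeRing zero = record
    { isRing = record
      { +-isAbelianGroup = +-isAbelianGroup 0
      ; *-cong     = λ { p q [] → A.+-congʳ (A.*-cong (p []) (q [])) }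
      ; *-assoc    = λ { f g h [] → A.+-congʳ (A.trans (A.*-congʳ (A.+-identityʳ _))
                           (A.trans (A.*-assoc _ _ _) (A.*-congˡ (A.sym (A.+-identityʳ _))))) }
      ; *-identity = (λ { f [] → A.trans (A.+-identityʳ _) (A.*-identityˡ _) })
                   , (λ { f [] → A.trans (A.+-identityʳ _) (A.*-identityʳ _) })
      ; distrib    = (λ { f g h [] → A.trans (A.+-identityʳ _) (A.trans (A.distribˡ _ _ _)
                           (A.sym (A.+-cong (A.+-identityʳ _) (A.+-identityʳ _)))) })
                   , (λ { f g h [] → A.trans (A.+-identityʳ _) (A.trans (A.distribʳ _ _ _)
                           (A.sym (A.+-cong (A.+-identityʳ _) (A.+-identityʳ _)))) }) }
    ; *-comm = λ { f g [] → A.+-congʳ (A.*-comm _ _) } }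
  isCommutativeRing (suc m) = record
    { isRing = record
      { +-isAbelianGroup = +-isAbelianGroup (suc m)
      ; *-cong     = λ {f} {f′} {g} {g′} p q → λ { (x ∷ es) → A.trans (*-as-conv m f g x es)
                       (A.trans (C.conv-cong (λ a es → p (a ∷ es)) (λ a es → q (a ∷ es)) x es)
                                (A.sym (*-as-conv m f′ g′ x es))) }
      ; *-assoc    = assoc
      ; *-identity = identityˡ , (λ f e → A.trans (comm f (P.1# (suc m)) e) (identityˡ f e))
      ; distrib    = (λ f g h e → A.trans (comm f (P._+_ (suc m) g h) e)
                        (A.trans (distribʳ f g h e) (A.+-cong (comm g f e) (comm h f e))))
                   , distribʳ }
    ; *-comm = comm }
    where
    B : CommutativeRing c ℓ
    B = record
      { Carrier = Coeffs m
      ; _≈_ = P._≈_ m ; _+_ = P._+_ m ; _*_ = P._*_ m ; -_ = P.-_ m ; 0# = P.0# m ; 1# = P.1# m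
      ; isCommutativeRing = isCommutativeRing m }
    module C = Sums B
    _*′_ = P._*_ (suc m)
    _≈′_ = P._≈_ (suc m)

    assoc : ∀ f g h → ((f *′ g) *′ h) ≈′ (f *′ (g *′ h))
    assoc f g h (x ∷ es) = begin
      ((f *′ g) *′ h) (x ∷ es)                           ≈⟨ *-as-conv m _ h x es ⟩
      C.conv (curry (f *′ g)) (curry h) x es             ≈⟨ C.conv-cong {g = curry h} (λ a → *-as-conv m f g a) (λ a es → A.refl) x es ⟩
      C.conv (C.conv (curry f) (curry g)) (curry h) x es ≈⟨ C.conv-assoc x (curry f) (curry g) (curry h) es ⟩
      C.conv (curry f) (C.conv (curry g) (curry h)) x es ≈⟨ C.conv-cong {f = curry f} (λ a es → A.refl) (λ a es → A.sym (*-as-conv m g h a es)) x es ⟩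
      C.conv (curry f) (curry (g *′ h)) x es             ≈⟨ A.sym (*-as-conv m f _ x es) ⟩
      (f *′ (g *′ h)) (x ∷ es)                           ∎

    comm : ∀ f g → (f *′ g) ≈′ (g *′ f)
    comm f g (x ∷ es) = A.trans (*-as-conv m f g x es)
      (A.trans (C.conv-comm x (curry f) (curry g) es) (A.sym (*-as-conv m g f x es)))

    identityˡ : ∀ f → (P.1# (suc m) *′ f) ≈′ f
    identityˡ f (x ∷ es) = A.trans (*-as-conv m _ f x es)
      (C.conv-identityˡ (curry (P.1# (suc m))) (curry f) (1-head-zero m) (λ a es → 1-head-suc m a es) x es)

    distribʳ : ∀ f g h → (P._+_ (suc m) g h *′ f) ≈′ P._+_ (suc m) (g *′ f) (h *′ f)
    distribʳ f g h (x ∷ es) = A.trans (*-as-conv m _ f x es)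
      (A.trans (C.conv-distribʳ (curry g) (curry h) (curry f) x es)
               (A.sym (A.+-cong (*-as-conv m g f x es) (*-as-conv m h f x es))))

  PolyRing : ℕ → CommutativeRing c ℓ
  PolyRing n = record
    { Carrier = Coeffs n
    ; _≈_ = P._≈_ n ; _+_ = P._+_ n ; _*_ = P._*_ n ; -_ = P.-_ n ; 0# = P.0# n ; 1# = P.1# n
    ; isCommutativeRing = isCommutativeRing n }

  -- Multiplication by the variable Y_{p+1}: the coefficient at e is that
  -- of f at e with the (p+1)-st exponent lowered by one (0 if it is 0).
  mulVar : ∀ {n} → ℕ → Coeffs n → Coeffs n
  mulVar p       f []          = A.0#
  mulVar zero    f (zero ∷ e)  = A.0#
  mulVar zero    f (suc x ∷ e) = f (x ∷ e)
  mulVar (suc p) f (x ∷ e)     = mulVar p (curry f x) e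

  mulVar-cong : ∀ {n} p {f g : Coeffs n} → P._≈_ n f g → P._≈_ n (mulVar p f) (mulVar p g)
  mulVar-cong p       eq []          = A.refl
  mulVar-cong zero    eq (zero ∷ e)  = A.refl
  mulVar-cong zero    eq (suc x ∷ e) = eq (x ∷ e)
  mulVar-cong (suc p) eq (x ∷ e)     = mulVar-cong p (λ e′ → eq (x ∷ e′)) e

  mulVar-zero : ∀ {n} p {f : Coeffs n} → (∀ e → f e A.≈ A.0#) → ∀ e → mulVar p f e A.≈ A.0#
  mulVar-zero p       eq []          = A.refl
  mulVar-zero zero    eq (zero ∷ e)  = A.refl
  mulVar-zero zero    eq (suc x ∷ e) = eq (x ∷ e)
  mulVar-zero (suc p) eq (x ∷ e)     = mulVar-zero p (λ e′ → eq (x ∷ e′)) e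

  mulVar-+ : ∀ {n} p (f g : Coeffs n) e → mulVar p (P._+_ n f g) e A.≈ mulVar p f e A.+ mulVar p g e
  mulVar-+ p       f g []          = A.sym (A.+-identityˡ _)
  mulVar-+ zero    f g (zero ∷ e)  = A.sym (A.+-identityˡ _)
  mulVar-+ zero    f g (suc x ∷ e) = A.refl
  mulVar-+ (suc p) f g (x ∷ e)     = mulVar-+ p _ _ e

  mulVar-neg : ∀ {n} p (f : Coeffs n) e → mulVar p (P.-_ n f) e A.≈ A.- mulVar p f e
  mulVar-neg p       f []          = A.sym AP.-0#≈0#
  mulVar-neg zero    f (zero ∷ e)  = A.sym AP.-0#≈0#
  mulVar-neg zero    f (suc x ∷ e) = A.refl
  mulVar-neg (suc p) f (x ∷ e)     = mulVar-neg p _ e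

  mulVar-ΣP : ∀ m p n ψ es → mulVar p (ΣP m n ψ) es A.≈ ΣP m n (λ a → mulVar p (ψ a)) es
  mulVar-ΣP m p zero    ψ es = mulVar-zero p (λ e → A.refl) es
  mulVar-ΣP m p (suc n) ψ es =
    A.trans (mulVar-+ p (ψ 0) (ΣP m n (ψ ∘ suc)) es) (A.+-congˡ (mulVar-ΣP m p n (ψ ∘ suc) es))

  mulVar-* : ∀ n p (g f : Coeffs n) e → P._*_ n (mulVar p g) f e A.≈ mulVar p (P._*_ n g f) e
  mulVar-* zero    p       g f []           = A.trans (A.+-identityʳ _) (A.zeroˡ _)
  mulVar-* (suc m) zero    g f (zero ∷ es)  =
    A.trans (*-as-conv m _ f 0 es) (A.trans (A.+-identityʳ _) (B.zeroˡ (curry f 0) es))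
    where module B = CommutativeRing (PolyRing m)
  mulVar-* (suc m) zero    g f (suc x ∷ es) =
    A.trans (*-as-conv m _ f (suc x) es) (A.trans (A.+-congʳ (B.zeroˡ (curry f (suc x)) es))
      (A.trans (A.+-identityˡ _) (A.sym (*-as-conv m g f x es))))
    where module B = CommutativeRing (PolyRing m)
  mulVar-* (suc m) (suc p) g f (x ∷ es) = begin
    P._*_ (suc m) (mulVar (suc p) g) f (x ∷ es)
      ≈⟨ *-as-conv m _ f x es ⟩
    C.conv (λ a → mulVar p (curry g a)) (curry f) x es
      ≈⟨ C.Σ<-cong (suc x) (λ a _ → mulVar-* m p (curry g a) (curry f (x ∸ a))) es ⟩
    ΣP m (suc x) (λ a → mulVar p (P._*_ m (curry g a) (curry f (x ∸ a)))) es
      ≈⟨ A.sym (mulVar-ΣP m p (suc x) (λ a → P._*_ m (curry g a) (curry f (x ∸ a))) es) ⟩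
    mulVar p (C.conv (curry g) (curry f) x) es
      ≈⟨ mulVar-cong p (λ e → A.sym (*-as-conv m g f x e)) es ⟩
    mulVar (suc p) (P._*_ (suc m) g f) (x ∷ es) ∎
    where module C = Sums (PolyRing m)

  scale : ∀ {n} → A.Carrier → Coeffs n → Coeffs n
  scale k f e = k A.* f e

  scale-ΣP : ∀ m k n ψ es → ΣP m n (λ a → scale k (ψ a)) es A.≈ scale k (ΣP m n ψ) es
  scale-ΣP m k zero    ψ es = A.sym (A.zeroʳ k)
  scale-ΣP m k (suc n) ψ es = A.trans (A.+-congˡ (scale-ΣP m k n (ψ ∘ suc) es)) (A.sym (A.distribˡ k _ _))

  scale-* : ∀ n k (g f : Coeffs n) e → P._*_ n (scale k g) f e A.≈ scale k (P._*_ n g f) e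
  scale-* zero    k g f []       =
    A.trans (A.+-congʳ (A.*-assoc _ _ _)) (A.trans (A.+-identityʳ _) (A.*-congˡ (A.sym (A.+-identityʳ _))))
  scale-* (suc m) k g f (x ∷ es) = begin
    P._*_ (suc m) (scale k g) f (x ∷ es)
      ≈⟨ *-as-conv m _ f x es ⟩
    C.conv (λ a → scale k (curry g a)) (curry f) x es
      ≈⟨ C.Σ<-cong (suc x) (λ a _ → scale-* m k (curry g a) (curry f (x ∸ a))) es ⟩
    ΣP m (suc x) (λ a → scale k (P._*_ m (curry g a) (curry f (x ∸ a)))) es
      ≈⟨ scale-ΣP m k (suc x) (λ a → P._*_ m (curry g a) (curry f (x ∸ a))) es ⟩
    scale k (C.conv (curry g) (curry f) x) es
      ≈⟨ A.*-congˡ (A.sym (*-as-conv m g f x es)) ⟩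
    scale k (P._*_ (suc m) g f) (x ∷ es) ∎
    where module C = Sums (PolyRing m)

  private
    unit : ∀ n → Fin n → Vec ℕ n
    unit n k = Vec.updateAt (replicate n 0) k (λ _ → 1)

  var-at-unit : ∀ n (k : Fin n) e → e ≡ unit n k → var Aᵒ k e A.≈ A.1#
  var-at-unit n k e p with ≡-dec _≟_ e (unit n k)
  ... | yes _ = A.refl
  ... | no ¬p = ⊥-elim (¬p p)

  var-off-unit : ∀ n (k : Fin n) e → ¬ e ≡ unit n k → var Aᵒ k e A.≈ A.0#
  var-off-unit n k e ¬p with ≡-dec _≟_ e (unit n k)
  ... | yes p = ⊥-elim (¬p p)
  ... | no _  = A.refl

  const-at-origin : ∀ n k e → e ≡ replicate n 0 → const Aᵒ k e A.≈ k
  const-at-origin n k e p with ≡-dec _≟_ e (replicate n 0)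
  ... | yes _ = A.refl
  ... | no ¬p = ⊥-elim (¬p p)

  const-off-origin : ∀ n k e → ¬ e ≡ replicate n 0 → const Aᵒ k e A.≈ A.0#
  const-off-origin n k e ¬p with ≡-dec _≟_ e (replicate n 0)
  ... | yes p = ⊥-elim (¬p p)
  ... | no _  = A.refl

  const≈scale : ∀ n k → P._≈_ n (const Aᵒ k) (scale k (P.1# n))
  const≈scale n k e = by-cases (≡-dec _≟_ e (replicate n 0))
    where
    by-cases : Dec (e ≡ replicate n 0) → const Aᵒ k e A.≈ scale k (P.1# n) e
    by-cases (yes p) = A.trans (const-at-origin n k e p)
      (A.trans (A.sym (A.*-identityʳ k)) (A.*-congˡ (A.sym (1-at-origin n e p))))
    by-cases (no ¬p) = A.trans (const-off-origin n k e ¬p)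
      (A.trans (A.sym (A.zeroʳ k)) (A.*-congˡ (A.sym (1-off-origin n e ¬p))))

  var≈mulVar : ∀ n (k : Fin n) → P._≈_ n (var Aᵒ k) (mulVar (toℕ k) (P.1# n))
  var≈mulVar (suc m) Fin.zero    (zero ∷ es)  = var-off-unit (suc m) Fin.zero (zero ∷ es) (λ ())
  var≈mulVar (suc m) Fin.zero    (suc x ∷ es) = by-cases (≡-dec _≟_ (x ∷ es) (replicate (suc m) 0))
    where
    by-cases : Dec (x ∷ es ≡ replicate (suc m) 0) → var Aᵒ Fin.zero (suc x ∷ es) A.≈ P.1# (suc m) (x ∷ es)
    by-cases (yes q) = A.trans (var-at-unit (suc m) Fin.zero (suc x ∷ es) (Eq.cong (λ { (y ∷ ys) → suc y ∷ ys }) q))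
                               (A.sym (1-at-origin (suc m) (x ∷ es) q))
    by-cases (no ¬q) = A.trans (var-off-unit (suc m) Fin.zero (suc x ∷ es) (¬q ∘ Eq.cong (λ { (y ∷ ys) → ℕ.pred y ∷ ys })))
                               (A.sym (1-off-origin (suc m) (x ∷ es) ¬q))
  var≈mulVar (suc m) (Fin.suc k) (zero ∷ es)  = A.trans (by-cases (≡-dec _≟_ es (unit m k)))
    (A.trans (var≈mulVar m k es) (mulVar-cong (toℕ k) (λ e → A.sym (1-head-zero m e)) es))
    where
    by-cases : Dec (es ≡ unit m k) → var Aᵒ (Fin.suc k) (zero ∷ es) A.≈ var Aᵒ k es
    by-cases (yes q) = A.trans (var-at-unit (suc m) (Fin.suc k) (zero ∷ es) (Eq.cong (zero ∷_) q)) (A.sym (var-at-unit m k es q))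
    by-cases (no ¬q) = A.trans (var-off-unit (suc m) (Fin.suc k) (zero ∷ es) (¬q ∘ Eq.cong Vec.tail)) (A.sym (var-off-unit m k es ¬q))
  var≈mulVar (suc m) (Fin.suc k) (suc x ∷ es) = A.trans (var-off-unit (suc m) (Fin.suc k) (suc x ∷ es) (λ ()))
    (A.sym (mulVar-zero (toℕ k) (1-head-suc m x) es))

  var-* : ∀ n (k : Fin n) (f : Coeffs n) → P._≈_ n (P._*_ n (var Aᵒ k) f) (mulVar (toℕ k) f)
  var-* n k f e = begin
    P._*_ n (var Aᵒ k) f e                   ≈⟨ Pₙ.*-congʳ {f} (var≈mulVar n k) e ⟩
    P._*_ n (mulVar (toℕ k) (P.1# n)) f e    ≈⟨ mulVar-* n (toℕ k) (P.1# n) f e ⟩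
    mulVar (toℕ k) (P._*_ n (P.1# n) f) e    ≈⟨ mulVar-cong (toℕ k) (Pₙ.*-identityˡ f) e ⟩
    mulVar (toℕ k) f e                       ∎
    where module Pₙ = CommutativeRing (PolyRing n)

  const-* : ∀ n k (f : Coeffs n) → P._≈_ n (P._*_ n (const Aᵒ k) f) (scale k f)
  const-* n k f e = begin
    P._*_ n (const Aᵒ k) f e          ≈⟨ Pₙ.*-congʳ {f} (const≈scale n k) e ⟩
    P._*_ n (scale k (P.1# n)) f e    ≈⟨ scale-* n k (P.1# n) f e ⟩
    scale k (P._*_ n (P.1# n) f) e    ≈⟨ A.*-congˡ (Pₙ.*-identityˡ f e) ⟩
    scale k f e                       ∎
    where module Pₙ = CommutativeRing (PolyRing n)

  const-isRingHomomorphism : ∀ n →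
    IsRingHomomorphism A.rawRing (CommutativeRing.rawRing (PolyRing n)) (const Aᵒ)
  const-isRingHomomorphism n = record
    { isSemiringHomomorphism = record
      { isNearSemiringHomomorphism = record
        { +-isMonoidHomomorphism = record
          { isMagmaHomomorphism = record
            { isRelHomomorphism = record { cong = λ {a} {b} a≈b → via (λ e → A.trans (A.*-congʳ a≈b) (A.sym (const≈scale n b e))) }
            ; homo = λ a b → via (λ e → A.trans (A.distribʳ _ a b) (A.sym (A.+-cong (const≈scale n a e) (const≈scale n b e)))) }
          ; ε-homo = via (λ e → A.zeroˡ _) }
        ; *-homo = λ a b → Pₙ.trans (via (λ e → A.trans (A.*-assoc a b _) (A.*-congˡ (A.sym (const≈scale n b e)))))
                                    (Pₙ.sym (const-* n a (const Aᵒ b))) }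
      ; 1#-homo = via (λ e → A.*-identityˡ _) }
    ; -‿homo = λ a → via (λ e → A.trans (A.sym (AP.-‿distribˡ-* a _)) (A.-‿cong (A.sym (const≈scale n a e)))) }
    where
    module Pₙ = CommutativeRing (PolyRing n)
    via : ∀ {a} {g : Coeffs n} → (∀ e → a A.* P.1# n e A.≈ g e) → P._≈_ n (const Aᵒ a) g
    via {a} h e = A.trans (const≈scale n a e) (h e)

  coeff : Coeffs 1 → ℕ → A.Carrier
  coeff f a = f (a ∷ [])

  coeff-* : ∀ (f g : Coeffs 1) n → coeff (P._*_ 1 f g) n A.≈ Sums.conv A (coeff f) (coeff g) n
  coeff-* f g n = A.trans (*-as-conv 0 f g n [])
    (A.trans (A.reflexive (ΣP-at 0 (suc n) (λ a → P._*_ 0 (curry f a) (curry g (n ∸ a))) []))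
             (Sums.Σ<-cong A (suc n) {ψ = λ a → coeff f a A.* coeff g (n ∸ a)} (λ a _ → A.+-identityʳ _)))

  coeff-Tᵢ : ∀ i n → coeff (powA (Poly Aᵒ 1) (var Aᵒ Fin.zero) i) n A.≈ δ n i
  coeff-Tᵢ zero    zero    = 1-at-origin 1 (0 ∷ []) Eq.refl
  coeff-Tᵢ zero    (suc n) = 1-head-suc 0 n []
  coeff-Tᵢ (suc i) zero    = var-* 1 Fin.zero (powA (Poly Aᵒ 1) (var Aᵒ Fin.zero) i) (0 ∷ [])
  coeff-Tᵢ (suc i) (suc n) =
    A.trans (var-* 1 Fin.zero (powA (Poly Aᵒ 1) (var Aᵒ Fin.zero) i) (suc n ∷ [])) (coeff-Tᵢ i n)

  sumA-at : ∀ n (L : List (Coeffs n)) e → sumA (Poly Aᵒ n) L e ≡ sumList (map (λ f → f e) L)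
  sumA-at n []      e = Eq.refl
  sumA-at n (f ∷ L) e = Eq.cong (f e A.+_) (sumA-at n L e)

module Signs {c ℓ} (R : CommutativeRing c ℓ) where
  open CommutativeRing R
  open RingProperties ring using (-0#≈0#; -‿+-comm; -‿distribˡ-*; -‿distribʳ-*; -‿involutive)

  signed : ℕ → Carrier → Carrier
  signed zero    x = x
  signed (suc t) x = - signed t x

  signed-cong : ∀ t {x y} → x ≈ y → signed t x ≈ signed t y
  signed-cong zero    eq = eq
  signed-cong (suc t) eq = -‿cong (signed-cong t eq)

  signed-zero : ∀ t {x} → x ≈ 0# → signed t x ≈ 0#
  signed-zero zero    eq = eq
  signed-zero (suc t) eq = trans (-‿cong (signed-zero t eq)) -0#≈0#

  signed-+ : ∀ t x y → signed t (x + y) ≈ signed t x + signed t y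
  signed-+ zero    x y = refl
  signed-+ (suc t) x y = trans (-‿cong (signed-+ t x y)) (sym (-‿+-comm _ _))

  signed-*ˡ : ∀ t x y → signed t (x * y) ≈ signed t x * y
  signed-*ˡ zero    x y = refl
  signed-*ˡ (suc t) x y = trans (-‿cong (signed-*ˡ t x y)) (-‿distribˡ-* _ _)

  signed-square : ∀ t → signed t 1# * signed t 1# ≈ 1#
  signed-square zero    = *-identityˡ _
  signed-square (suc t) = trans (sym (-‿distribˡ-* _ _))
    (trans (-‿cong (sym (-‿distribʳ-* _ _))) (trans (-‿involutive _) (signed-square t)))

-- Being
-- homogeneous of degree p (S = {deg ≠ p}) and having support of degree
-- ≤ N (S = {deg > N}) are of this form, and so is "the last variable
-- does not occur"; all three are closed under the additive operations.

module Vanishing {c ℓ} (A : CommutativeRing c ℓ) where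
  open Polynomials A
  open Sums A using (sumList; sumList-concatMap; sumList-upTo)

  VanishesOn : ∀ {n} → (Vec ℕ n → Set) → Coeffs n → Set ℓ
  VanishesOn S f = ∀ e → S e → f e A.≈ A.0#

  module _ {n} {S : Vec ℕ n → Set} where

    vanishes-cong : ∀ {f g} → P._≈_ n f g → VanishesOn S f → VanishesOn S g
    vanishes-cong eq v e s = A.trans (A.sym (eq e)) (v e s)

    vanishes-0 : ∀ {f} → (∀ e → f e A.≈ A.0#) → VanishesOn S f
    vanishes-0 z e _ = z e

    vanishes-+ : ∀ {f g} → VanishesOn S f → VanishesOn S g → VanishesOn S (P._+_ n f g)
    vanishes-+ vf vg e s = A.trans (A.+-cong (vf e s) (vg e s)) (A.+-identityˡ _)

    vanishes-neg : ∀ {f} → VanishesOn S f → VanishesOn S (P.-_ n f)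
    vanishes-neg vf e s = A.trans (A.-‿cong (vf e s)) AP.-0#≈0#

    vanishes-scale : ∀ k {f} → VanishesOn S f → VanishesOn S (scale k f)
    vanishes-scale k vf e s = A.trans (A.*-congˡ (vf e s)) (A.zeroʳ k)

    vanishes-signed : ∀ t {f} → VanishesOn S f → VanishesOn S (Signs.signed (PolyRing n) t f)
    vanishes-signed zero    vf = vf
    vanishes-signed (suc t) vf = vanishes-neg (vanishes-signed t vf)

    vanishes-ΣP : ∀ k (ψ : ℕ → Coeffs n) → (∀ a → a < k → VanishesOn S (ψ a)) → VanishesOn S (ΣP n k ψ)
    vanishes-ΣP zero    ψ v e s = A.refl
    vanishes-ΣP (suc k) ψ v = vanishes-+ (v 0 (s≤s z≤n)) (vanishes-ΣP k (ψ ∘ suc) (λ a lt → v (suc a) (s≤s lt)))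

  splits-sum-zero : ∀ {n} (e : Vec ℕ n) (F : Vec ℕ n × Vec ℕ n → A.Carrier) →
    (∀ a b → deg a ℕ.+ deg b ≡ deg e → F (a , b) A.≈ A.0#) → sumList (map F (splits e)) A.≈ A.0#
  splits-sum-zero []       F h = A.trans (A.+-identityʳ _) (h [] [] Eq.refl)
  splits-sum-zero (x ∷ es) F h =
    A.trans (sumList-concatMap F (λ a → map (prepend a) (splits es)) (upTo (suc x)))
      (A.trans (A.reflexive (sumList-upTo _ (suc x))) (Sums.Σ<-zero A (suc x) term))
    where
    prepend : ℕ → Vec ℕ _ × Vec ℕ _ → Vec ℕ _ × Vec ℕ _
    prepend a p = (a ∷ proj₁ p , (x ∸ a) ∷ proj₂ p)
    degrees : ∀ a y z → a ≤ x → y ℕ.+ z ≡ deg es → (a ℕ.+ y) ℕ.+ ((x ∸ a) ℕ.+ z) ≡ x ℕ.+ deg es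
    degrees a y z a≤x eq =
      Eq.trans (ℕ-interchange a y (x ∸ a) z) (Eq.cong₂ ℕ._+_ (ℕP.m+[n∸m]≡n a≤x) eq)
      where open import Algebra.Properties.CommutativeSemigroup ℕP.+-commutativeSemigroup
              renaming (interchange to ℕ-interchange)
    term : ∀ a → a < suc x → sumList (map F (map (prepend a) (splits es))) A.≈ A.0#
    term a (s≤s a≤x) = A.trans (A.reflexive (Eq.cong sumList (Eq.sym (ListP.map-∘ (splits es)))))
      (splits-sum-zero es (F ∘ prepend a)
        (λ as bs eq → h (a ∷ as) ((x ∸ a) ∷ bs) (degrees a (deg as) (deg bs) a≤x eq)))

  IsHom : ∀ {n} → ℕ → Coeffs n → Set ℓ
  IsHom p f = IsHomogeneous Aᵒ p f

  hom-* : ∀ {n p q} {f g : Coeffs n} → IsHom p f → IsHom q g → IsHom (p ℕ.+ q) (P._*_ n f g)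
  hom-* {n} {p} {q} {f} {g} hf hg e ne = splits-sum-zero e (λ ab → f (proj₁ ab) A.* g (proj₂ ab)) term
    where
    term : ∀ a b → deg a ℕ.+ deg b ≡ deg e → f a A.* g b A.≈ A.0#
    term a b eq with deg a ≟ p | deg b ≟ q
    ... | no  ≠p | _      = A.trans (A.*-congʳ (hf a ≠p)) (A.zeroˡ _)
    ... | yes _  | no ≠q  = A.trans (A.*-congˡ (hg b ≠q)) (A.zeroʳ _)
    ... | yes =p | yes =q = ⊥-elim (ne (Eq.trans (Eq.sym eq) (Eq.cong₂ ℕ._+_ =p =q)))

  deg-origin : ∀ n → deg (replicate n 0) ≡ 0
  deg-origin zero    = Eq.refl
  deg-origin (suc n) = deg-origin n

  hom-1 : ∀ n → IsHom 0 (P.1# n)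
  hom-1 n e ne = 1-off-origin n e (λ eq → ne (Eq.trans (Eq.cong deg eq) (deg-origin n)))

  Bounded : ∀ {n} → ℕ → Coeffs n → Set ℓ
  Bounded N f = IsPolyBound Aᵒ N f

  bounded-mono : ∀ {n B B′} {f : Coeffs n} → B ≤ B′ → Bounded B f → Bounded B′ f
  bounded-mono le bf e lt = bf e (ℕP.≤-<-trans le lt)

  bounded-1 : ∀ n → Bounded 0 (P.1# n)
  bounded-1 n e lt = 1-off-origin n e (λ eq → ℕP.<-irrefl (Eq.sym (Eq.trans (Eq.cong deg eq) (deg-origin n))) lt)

  bounded-mulVar : ∀ {n B} p {f : Coeffs n} → Bounded B f → Bounded (suc B) (mulVar p f)
  bounded-mulVar p {f} bf e lt = go p f 0 e bf lt
    where
    -- generalised over the degree d already consumed by the prefix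
    go : ∀ {n B} p (f : Coeffs n) d e → (∀ e′ → B < d ℕ.+ deg e′ → f e′ A.≈ A.0#) →
         suc B < d ℕ.+ deg e → mulVar p f e A.≈ A.0#
    go p       f d []          h lt = A.refl
    go zero    f d (zero ∷ es) h lt = A.refl
    go zero    f d (suc x ∷ es) h lt =
      h (x ∷ es) (ℕP.≤-pred (ℕP.<-≤-trans lt (ℕP.≤-reflexive (ℕP.+-suc d (x ℕ.+ deg es)))))
    go (suc p) f d (x ∷ es) h lt = go p (curry f x) (d ℕ.+ x) es
      (λ e′ lt′ → h (x ∷ e′) (ℕP.<-≤-trans lt′ (ℕP.≤-reflexive (ℕP.+-assoc d x (deg e′)))))
      (ℕP.<-≤-trans lt (ℕP.≤-reflexive (Eq.sym (ℕP.+-assoc d x (deg es)))))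

  NoLast : ∀ {k} → Coeffs (suc k) → Set ℓ
  NoLast {k} f = ∀ (rest : Vec ℕ k) x → f (rest ∷ʳ suc x) A.≈ A.0#

  noLast-+ : ∀ {k} {f g : Coeffs (suc k)} → NoLast f → NoLast g → NoLast (P._+_ (suc k) f g)
  noLast-+ nf ng rest x = A.trans (A.+-cong (nf rest x) (ng rest x)) (A.+-identityˡ _)

  noLast-signed : ∀ {k} t {f : Coeffs (suc k)} → NoLast f → NoLast (Signs.signed (PolyRing (suc k)) t f)
  noLast-signed zero    nf = nf
  noLast-signed (suc t) nf rest x = A.trans (A.-‿cong (noLast-signed t nf rest x)) AP.-0#≈0#

  noLast-ΣP : ∀ {k} m (ψ : ℕ → Coeffs (suc k)) → (∀ a → a < m → NoLast (ψ a)) → NoLast (ΣP (suc k) m ψ)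
  noLast-ΣP zero    ψ h rest x = A.refl
  noLast-ΣP (suc m) ψ h = noLast-+ {f = ψ 0} {g = ΣP _ m (ψ ∘ suc)} (h 0 (s≤s z≤n)) (noLast-ΣP m (ψ ∘ suc) (λ a lt → h (suc a) (s≤s lt)))

  noLast-1 : ∀ k → NoLast (P.1# (suc k))
  noLast-1 k rest x = 1-off-origin (suc k) (rest ∷ʳ suc x) (not-origin rest)
    where
    not-origin : ∀ {k} (rest : Vec ℕ k) → ¬ rest ∷ʳ suc x ≡ replicate (suc k) 0
    not-origin []         ()
    not-origin (y ∷ rest) eq = not-origin rest (Eq.cong Vec.tail eq)

  noLast-mulVar : ∀ {k} p {f : Coeffs (suc k)} → p < k → NoLast f → NoLast (mulVar p f)
  noLast-mulVar zero    (s≤s z≤n) nf (zero ∷ rest)  x = A.refl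
  noLast-mulVar zero    (s≤s z≤n) nf (suc y ∷ rest) x = nf (y ∷ rest) x
  noLast-mulVar (suc p) (s≤s lt)  nf (y ∷ rest)     x = noLast-mulVar p lt (λ rest′ → nf (y ∷ rest′)) rest x

  mulVar-last : ∀ {k} (f : Coeffs (suc k)) (rest : Vec ℕ k) y → mulVar k f (rest ∷ʳ suc y) ≡ f (rest ∷ʳ y)
  mulVar-last f []         y = Eq.refl
  mulVar-last f (z ∷ rest) y = mulVar-last (curry f z) rest y

  monic-linear : ∀ {k} (f : Coeffs (suc k)) →
    (∀ rest x → f (rest ∷ʳ suc x) A.≈ P.1# (suc k) (rest ∷ʳ x)) → IsMonicLast Aᵒ f
  monic-linear {k} f shifted = 1 , leading , lower , higher
    where
    origin∷ʳ0 : ∀ k → replicate k 0 ∷ʳ 0 ≡ replicate (suc k) 0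
    origin∷ʳ0 zero    = Eq.refl
    origin∷ʳ0 (suc k) = Eq.cong (0 ∷_) (origin∷ʳ0 k)
    origin-init : ∀ {k} (rest : Vec ℕ k) → rest ∷ʳ 0 ≡ replicate (suc k) 0 → rest ≡ replicate k 0
    origin-init []         eq = Eq.refl
    origin-init (x ∷ rest) eq = Eq.cong₂ _∷_ (Eq.cong Vec.head eq) (origin-init rest (Eq.cong Vec.tail eq))
    leading : f (replicate k 0 ∷ʳ 1) A.≈ A.1#
    leading = A.trans (shifted (replicate k 0) 0) (1-at-origin (suc k) _ (origin∷ʳ0 k))
    lower : ∀ rest → ¬ rest ≡ replicate k 0 → f (rest ∷ʳ 1) A.≈ A.0#
    lower rest ne = A.trans (shifted rest 0) (1-off-origin (suc k) _ (ne ∘ origin-init rest))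
    higher : ∀ m′ rest → 1 < m′ → f (rest ∷ʳ m′) A.≈ A.0#
    higher (suc zero)    rest (s≤s ())
    higher (suc (suc x)) rest _        = A.trans (shifted rest (suc x)) (noLast-1 k rest x)

-- Elementary symmetric polynomials e_d ∈ A[X₁,…,Xₙ] (coefficient 1 on the
-- squarefree monomials of degree d), and their "tails"
-- esymFrom p d = e_d(X_{p+1},…,Xₙ), which satisfy
--   e_{d+1}(X_{p+1},…) = e_{d+1}(X_{p+2},…) + X_{p+1}·e_d(X_{p+2},…).

module ElementarySymmetric {c ℓ} (A : CommutativeRing c ℓ) where
  open Polynomials A
  open Vanishing A

  esym : ∀ {n} → ℕ → Coeffs n
  esym zero    []                 = A.1#
  esym (suc d) []                 = A.0#
  esym d       (zero ∷ es)        = esym d es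
  esym zero    (suc zero ∷ es)    = A.0#
  esym (suc d) (suc zero ∷ es)    = esym d es
  esym d       (suc (suc _) ∷ es) = A.0#

  hom-esym : ∀ {n} d → IsHom {n} d (esym d)
  hom-esym zero    []                 ne = ⊥-elim (ne Eq.refl)
  hom-esym (suc d) []                 ne = A.refl
  hom-esym zero    (zero ∷ es)        ne = hom-esym zero es ne
  hom-esym (suc d) (zero ∷ es)        ne = hom-esym (suc d) es ne
  hom-esym zero    (suc zero ∷ es)    ne = A.refl
  hom-esym (suc d) (suc zero ∷ es)    ne = hom-esym d es (ne ∘ Eq.cong suc)
  hom-esym zero    (suc (suc x) ∷ es) ne = A.refl
  hom-esym (suc d) (suc (suc x) ∷ es) ne = A.refl

  esym-vanishes : ∀ {n} d (e : Vec ℕ n) → n < d → esym d e A.≈ A.0#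
  esym-vanishes (suc d) []                 lt       = A.refl
  esym-vanishes (suc d) (zero ∷ es)        lt       = esym-vanishes (suc d) es (ℕP.<-trans (ℕP.n<1+n _) lt)
  esym-vanishes (suc d) (suc zero ∷ es)    (s≤s lt) = esym-vanishes d es lt
  esym-vanishes (suc d) (suc (suc x) ∷ es) lt       = A.refl

  esym-0 : ∀ n → P._≈_ n (esym 0) (P.1# n)
  esym-0 zero    []                 = A.sym (1-at-origin 0 [] Eq.refl)
  esym-0 (suc n) (zero ∷ es)        = A.trans (esym-0 n es) (A.sym (1-head-zero n es))
  esym-0 (suc n) (suc zero ∷ es)    = A.sym (1-head-suc n 0 es)
  esym-0 (suc n) (suc (suc x) ∷ es) = A.sym (1-head-suc n (suc x) es)

  esymFrom : ∀ {n} → ℕ → ℕ → Coeffs n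
  esymFrom zero    d e           = esym d e
  esymFrom (suc p) d []          = esym d []
  esymFrom (suc p) d (zero ∷ e)  = esymFrom p d e
  esymFrom (suc p) d (suc _ ∷ e) = A.0#

  esymFrom-step-0 : ∀ {n} p (e : Vec ℕ n) → p < n → esymFrom p 0 e A.≈ esymFrom (suc p) 0 e
  esymFrom-step-0 zero    (zero ∷ es)        lt       = A.refl
  esymFrom-step-0 zero    (suc zero ∷ es)    lt       = A.refl
  esymFrom-step-0 zero    (suc (suc x) ∷ es) lt       = A.refl
  esymFrom-step-0 (suc p) (zero ∷ es)        (s≤s lt) = esymFrom-step-0 p es lt
  esymFrom-step-0 (suc p) (suc x ∷ es)       lt       = A.refl

  esymFrom-step : ∀ {n} p d (e : Vec ℕ n) → p < n →
    esymFrom p (suc d) e A.≈ esymFrom (suc p) (suc d) e A.+ mulVar p (esymFrom (suc p) d) e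
  esymFrom-step zero    d (zero ∷ es)        lt       = A.sym (A.+-identityʳ _)
  esymFrom-step zero    d (suc zero ∷ es)    lt       = A.sym (A.+-identityˡ _)
  esymFrom-step zero    d (suc (suc x) ∷ es) lt       = A.sym (A.+-identityˡ _)
  esymFrom-step (suc p) d (zero ∷ es)        (s≤s lt) = esymFrom-step p d es lt
  esymFrom-step (suc p) d (suc x ∷ es)       lt       =
    A.sym (A.trans (A.+-identityˡ _) (mulVar-zero p (λ e → A.refl) es))

  esymFrom-vanishes : ∀ {n} p d (e : Vec ℕ n) → p ≤ n → n < p ℕ.+ d → esymFrom p d e A.≈ A.0#
  esymFrom-vanishes zero    d e            le       lt       = esym-vanishes d e lt
  esymFrom-vanishes (suc p) d (zero ∷ es)  (s≤s le) (s≤s lt) = esymFrom-vanishes p d es le lt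
  esymFrom-vanishes (suc p) d (suc x ∷ es) le       lt       = A.refl

  esymFrom-end : ∀ n → P._≈_ n (esymFrom n 0) (P.1# n)
  esymFrom-end zero    []           = A.sym (1-at-origin 0 [] Eq.refl)
  esymFrom-end (suc m) (zero ∷ es)  = A.trans (esymFrom-end m es) (A.sym (1-head-zero m es))
  esymFrom-end (suc m) (suc x ∷ es) = A.sym (1-head-suc m x es)

-- Proved for the partial products
--   W p k = (T - X_{p+1})⋯(T - X_{p+k}),   p + k = r,
-- by induction on k, whose coefficients are the signed tails
-- (vietaCoeff p k).

module Vieta {c ℓ} (A : CommutativeRing c ℓ) (r : ℕ) where
  open Polynomials A
  open ElementarySymmetric A

  R : CommutativeRing c ℓ
  R = PolyRing r
  module R = CommutativeRing R
  module RP = RingProperties R.ring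
  module RT = Polynomials R
  module ΣR = Sums R
  open Signs R
  open SetoidReasoning R.setoid

  X : ℕ → R.Carrier
  X p = mulVar p (P.1# r)

  X-* : ∀ p w → X p R.* w R.≈ mulVar p w
  X-* p w e = A.trans (mulVar-* r p (P.1# r) w e) (mulVar-cong p (R.*-identityˡ w) e)

  signed-mulVar : ∀ t p x → mulVar p (signed t x) R.≈ signed t (mulVar p x)
  signed-mulVar zero    p x   = R.refl
  signed-mulVar (suc t) p x e = A.trans (mulVar-neg p (signed t x) e) (A.-‿cong (signed-mulVar t p x e))

  -- coefficient of Tⁿ in W p k: (-1)^{k-n} e_{k-n}(X_{p+1},…,X_r), 0 if n > k
  vietaCoeff : ℕ → ℕ → ℕ → R.Carrier
  vietaCoeff p k       zero    = signed k (esymFrom p k)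
  vietaCoeff p zero    (suc n) = R.0#
  vietaCoeff p (suc k) (suc n) = vietaCoeff p k n

  vietaCoeff-≤ : ∀ p k n → n ≤ k → vietaCoeff p k n ≡ signed (k ∸ n) (esymFrom p (k ∸ n))
  vietaCoeff-≤ p k       zero    le       = Eq.refl
  vietaCoeff-≤ p (suc k) (suc n) (s≤s le) = vietaCoeff-≤ p k n le

  vietaCoeff-> : ∀ p k n → k < n → vietaCoeff p k n ≡ R.0#
  vietaCoeff-> p zero    (suc n) lt       = Eq.refl
  vietaCoeff-> p (suc k) (suc n) (s≤s lt) = vietaCoeff-> p k n lt

  -- the recursion behind multiplying by T - X_{p+1}
  vietaCoeff-step : ∀ p → p < r → ∀ k n →
    vietaCoeff p k n R.≈ vietaCoeff (suc p) k n R.+ R.- mulVar p (vietaCoeff (suc p) k (suc n))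
  vietaCoeff-step p lt zero    zero    e = A.trans (esymFrom-step-0 p e lt)
    (A.sym (A.trans (A.+-congˡ (A.trans (A.-‿cong (mulVar-zero p (λ _ → A.refl) e)) AP.-0#≈0#)) (A.+-identityʳ _)))
  vietaCoeff-step p lt (suc k) zero    = begin
    R.- signed k (esymFrom p (suc k))
      ≈⟨ R.-‿cong (signed-cong k (λ e → esymFrom-step p k e lt)) ⟩
    R.- signed k (esymFrom (suc p) (suc k) R.+ mulVar p (esymFrom (suc p) k))
      ≈⟨ R.-‿cong (signed-+ k _ _) ⟩
    R.- (signed k (esymFrom (suc p) (suc k)) R.+ signed k (mulVar p (esymFrom (suc p) k)))
      ≈⟨ R.sym (RP.-‿+-comm _ _) ⟩
    R.- signed k (esymFrom (suc p) (suc k)) R.+ R.- signed k (mulVar p (esymFrom (suc p) k))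
      ≈⟨ R.+-congˡ (R.-‿cong (R.sym (signed-mulVar k p _))) ⟩
    R.- signed k (esymFrom (suc p) (suc k)) R.+ R.- mulVar p (signed k (esymFrom (suc p) k)) ∎
  vietaCoeff-step p lt zero    (suc n) e =
    A.sym (A.trans (A.+-congˡ (A.trans (A.-‿cong (mulVar-zero p (λ _ → A.refl) e)) AP.-0#≈0#)) (A.+-identityʳ _))
  vietaCoeff-step p lt (suc k) (suc n) = vietaCoeff-step p lt k n

  Rᵒ : RingOps c ℓ
  Rᵒ = ringOps R

  RTᵒ : RingOps c ℓ
  RTᵒ = Poly Rᵒ 1

  T : RT.Coeffs 1
  T = var Rᵒ Fin.zero

  factor : ℕ → RT.Coeffs 1
  factor p = RingOps._-_ RTᵒ T (const Rᵒ (X p))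

  factorCoeff : ℕ → ℕ → R.Carrier
  factorCoeff p zero          = R.- X p
  factorCoeff p (suc zero)    = R.1#
  factorCoeff p (suc (suc a)) = R.0#

  factor-coeff : ∀ p a → RT.coeff (factor p) a R.≈ factorCoeff p a
  factor-coeff p zero          = R.trans (R.+-cong (RT.var≈mulVar 1 Fin.zero (0 ∷ []))
      (R.-‿cong (RT.const-at-origin 1 _ (0 ∷ []) Eq.refl))) (R.+-identityˡ _)
  factor-coeff p (suc zero)    = R.trans (R.+-cong (R.trans (RT.var≈mulVar 1 Fin.zero (1 ∷ [])) (RT.1-at-origin 1 (0 ∷ []) Eq.refl))
      (R.-‿cong (RT.const-off-origin 1 (X p) (1 ∷ []) (λ ())))) (R.trans (R.+-congˡ RP.-0#≈0#) (R.+-identityʳ _))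
  factor-coeff p (suc (suc a)) = R.trans (R.+-cong (R.trans (RT.var≈mulVar 1 Fin.zero (suc (suc a) ∷ [])) (RT.1-head-suc 0 a []))
      (R.-‿cong (RT.const-off-origin 1 (X p) (suc (suc a) ∷ []) (λ ())))) (R.trans (R.+-congˡ RP.-0#≈0#) (R.+-identityʳ _))

  timesFactor : ℕ → (ℕ → R.Carrier) → ℕ → R.Carrier
  timesFactor p w zero    = R.- mulVar p (w 0)
  timesFactor p w (suc n) = R.- mulVar p (w (suc n)) R.+ w n

  conv-factor : ∀ p w n → ΣR.conv (factorCoeff p) w n R.≈ timesFactor p w n
  conv-factor p w zero    = begin
    R.- X p R.* w 0 R.+ R.0#  ≈⟨ R.+-identityʳ _ ⟩
    R.- X p R.* w 0           ≈⟨ R.sym (RP.-‿distribˡ-* _ _) ⟩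
    R.- (X p R.* w 0)         ≈⟨ R.-‿cong (X-* p (w 0)) ⟩
    R.- mulVar p (w 0)        ∎
  conv-factor p w (suc n) =
    R.+-cong (R.trans (R.sym (RP.-‿distribˡ-* _ _)) (R.-‿cong (X-* p (w (suc n)))))
             (ΣR.conv-identityˡ (factorCoeff p ∘ suc) w R.refl (λ a → R.refl) n)

  range : ℕ → ℕ → List ℕ
  range p zero    = []
  range p (suc k) = p ∷ range (suc p) k

  W : ℕ → ℕ → RT.Coeffs 1
  W p k = prodA RTᵒ (map factor (range p k))

  W-coeff : ∀ k p → p ℕ.+ k ≡ r → ∀ n → RT.coeff (W p k) n R.≈ vietaCoeff p k n
  W-coeff zero    p p+0≡r n = base (Eq.trans (Eq.sym (ℕP.+-identityʳ p)) p+0≡r) n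
    where
    base : p ≡ r → ∀ n → RT.coeff (W p 0) n R.≈ vietaCoeff p 0 n
    base Eq.refl zero    = R.trans (RT.1-at-origin 1 (0 ∷ []) Eq.refl) (R.sym (esymFrom-end p))
    base Eq.refl (suc n) = RT.1-head-suc 0 n []
  W-coeff (suc k) p p+k≡r n = begin
    RT.coeff (W p (suc k)) n                       ≈⟨ RT.coeff-* (factor p) (W (suc p) k) n ⟩
    ΣR.conv (RT.coeff (factor p)) (RT.coeff (W (suc p) k)) n
      ≈⟨ ΣR.conv-cong (factor-coeff p) (W-coeff k (suc p) (Eq.trans (Eq.sym (ℕP.+-suc p k)) p+k≡r)) n ⟩
    ΣR.conv (factorCoeff p) (vietaCoeff (suc p) k) n ≈⟨ conv-factor p (vietaCoeff (suc p) k) n ⟩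
    timesFactor p (vietaCoeff (suc p) k) n         ≈⟨ step n ⟩
    vietaCoeff p (suc k) n                         ∎
    where
    p<r : p < r
    p<r = Eq.subst (p <_) p+k≡r (ℕP.m<m+n p (s≤s z≤n))
    -- the top tail e_{k+1}(X_{p+2},…,X_r) vanishes: only k variables remain
    top-vanishes : ∀ e → esymFrom (suc p) (suc k) e A.≈ A.0#
    top-vanishes e = esymFrom-vanishes (suc p) (suc k) e
      (Eq.subst (suc p ≤_) p+k≡r (Eq.subst (suc p ≤_) (Eq.sym (ℕP.+-suc p k)) (s≤s (ℕP.m≤m+n p k))))
      (Eq.subst (_< suc p ℕ.+ suc k) p+k≡r (ℕP.n<1+n _))
    step : ∀ n → timesFactor p (vietaCoeff (suc p) k) n R.≈ vietaCoeff p (suc k) n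
    step zero    = R.sym (R.trans (vietaCoeff-step p p<r (suc k) zero)
      (R.trans (R.+-congʳ (signed-zero (suc k) top-vanishes)) (R.+-identityˡ _)))
    step (suc n) = R.trans (R.+-comm _ _) (R.sym (vietaCoeff-step p p<r k n))

  Qᵢ : Fin r → RT.Coeffs 1
  Qᵢ k = RingOps._-_ RTᵒ T (const Rᵒ (var Aᵒ k))

  Q : RT.Coeffs 1
  Q = prodA RTᵒ (Vec.toList (Vec.map Qᵢ (Vec.allFin r)))

  Q≈W : ∀ k p (g : Fin k → Fin r) → (∀ i → toℕ (g i) ≡ p ℕ.+ toℕ i) →
    RT.P._≈_ 1 (prodA RTᵒ (Vec.toList (Vec.map Qᵢ (Vec.tabulate g)))) (W p k)
  Q≈W zero    p g hg = RTR.refl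
    where module RTR = CommutativeRing (RT.PolyRing 1)
  Q≈W (suc k) p g hg = RTR.*-cong {Qᵢ (g Fin.zero)} {factor p} same-factor
      (Q≈W k (suc p) (g ∘ Fin.suc) (λ i → Eq.trans (hg (Fin.suc i)) (ℕP.+-suc p (toℕ i))))
    where
    module RTR = CommutativeRing (RT.PolyRing 1)
    same-var : var Aᵒ (g Fin.zero) R.≈ X p
    same-var e = A.trans (var≈mulVar r (g Fin.zero) e)
      (A.reflexive (Eq.cong (λ t → mulVar t (P.1# r) e) (Eq.trans (hg Fin.zero) (ℕP.+-identityʳ p))))
    same-factor : RT.P._≈_ 1 (Qᵢ (g Fin.zero)) (factor p)
    same-factor = RTR.+-cong {T} {T} RTR.refl (RTR.-‿cong (λ e → R.trans (RT.const≈scale 1 _ e)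
      (R.trans (R.*-congʳ same-var) (R.sym (RT.const≈scale 1 _ e)))))

  Q-coeff : ∀ a → RT.coeff Q a R.≈ vietaCoeff 0 r a
  Q-coeff a = R.trans (Q≈W r 0 (λ i → i) (λ i → Eq.refl) (a ∷ [])) (W-coeff r 0 Eq.refl a)

term-degree : ∀ r J n a → a ≤ n → n < r → n ∸ a ≤ J → (r ∸ a) ℕ.+ (J ∸ (n ∸ a)) ≡ J ℕ.+ r ∸ n
term-degree r J n a a≤n n<r n-a≤J = Eq.sym (begin
  J ℕ.+ r ∸ n                      ≡⟨ Eq.cong₂ (λ x y → x ℕ.+ y ∸ n) (Eq.sym (ℕP.m∸n+n≡m n-a≤J)) (Eq.sym (ℕP.m∸n+n≡m a≤r)) ⟩
  (v ℕ.+ u) ℕ.+ (w ℕ.+ a) ∸ n      ≡⟨ Eq.cong ((v ℕ.+ u) ℕ.+ (w ℕ.+ a) ∸_) (Eq.sym (ℕP.m∸n+n≡m a≤n)) ⟩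
  (v ℕ.+ u) ℕ.+ (w ℕ.+ a) ∸ (u ℕ.+ a) ≡⟨ Eq.cong (_∸ (u ℕ.+ a)) (ℕ-interchange v u w a) ⟩
  (v ℕ.+ w) ℕ.+ (u ℕ.+ a) ∸ (u ℕ.+ a) ≡⟨ ℕP.m+n∸n≡m (v ℕ.+ w) (u ℕ.+ a) ⟩
  v ℕ.+ w                          ≡⟨ ℕP.+-comm v w ⟩
  w ℕ.+ v                          ∎)
  where
  open Eq.≡-Reasoning renaming (begin_ to begin_; _∎ to _∎)
  open import Algebra.Properties.CommutativeSemigroup ℕP.+-commutativeSemigroup
    renaming (interchange to ℕ-interchange)
  u = n ∸ a
  v = J ∸ u
  w = r ∸ a
  a≤r : a ≤ r
  a≤r = ℕP.≤-trans a≤n (ℕP.<⇒≤ n<r)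

-- Over a commutative ring S, with maps
-- ε l standing for "multiply by the l-th elementary symmetric function",
-- put h₀ = 1 and
--   h_{t+1} = Σ_{l<r} (-1)ˡ·ε_{l+1}(h_{t-l})          (h_s = 0 for s < 0),
-- stored as the list hList t = h_t ∷ … ∷ h₀, and write G J b = h_{J-b}
-- (0 for b > J).  For ε_l = e_l·(-) in A[X₁,…,X_r] the sequence G J is
-- the quotient of T^{J+r} by Q, and the remainder coefficients are
--   Hexpr J n = - Σ_{a≤n} (-1)^{r-a}·ε_{r-a}(G J (n-a)).
-- For ε_l = Y_l·(-) in A[Y₁,…,Y_m] the same recursion produces
-- polynomials P with P(Π₁,…,Π_m) = H; this is why it is stated once,
-- for an arbitrary S and ε.

module Recurrence {c ℓ} (S : CommutativeRing c ℓ) (r : ℕ)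
                  (ε : ℕ → CommutativeRing.Carrier S → CommutativeRing.Carrier S) where
  open CommutativeRing S
  open Sums S using (Σ<; δ)
  open Signs S using (signed; signed-zero)

  at : List Carrier → ℕ → Carrier
  at []      _       = 0#
  at (x ∷ L) zero    = x
  at (x ∷ L) (suc l) = at L l

  hList : ℕ → List Carrier
  hList zero    = 1# ∷ []
  hList (suc t) = Σ< r (λ l → signed l (ε (suc l) (at (hList t) l))) ∷ hList t

  G : ℕ → ℕ → Carrier
  G J = at (hList J)

  Hexpr : ℕ → ℕ → Carrier
  Hexpr J n = - Σ< (suc n) (λ a → signed (r ∸ a) (ε (r ∸ a) (G J (n ∸ a))))

  G-last : ∀ J → G J J ≡ 1#
  G-last zero    = Eq.refl
  G-last (suc J) = G-last J

  G-beyond : ∀ J b → J < b → G J b ≡ 0#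
  G-beyond J b J<b = beyond (hList J) b (Eq.subst (_≤ b) (Eq.sym (length-hList J)) J<b)
    where
    beyond : ∀ L b → length L ≤ b → at L b ≡ 0#
    beyond []      b       _         = Eq.refl
    beyond (x ∷ L) (suc b) (s≤s le)  = beyond L b le
    length-hList : ∀ t → length (hList t) ≡ suc t
    length-hList zero    = Eq.refl
    length-hList (suc t) = Eq.cong suc (length-hList t)

  G-recursion : (∀ l → ε l 0# ≈ 0#) → ∀ J b →
    G J b ≈ δ b J + Σ< r (λ l → signed l (ε (suc l) (G J (b ℕ.+ suc l))))
  G-recursion ε-0 zero    zero    = sym (trans (+-congˡ (Sums.Σ<-zero S r (λ l _ → signed-zero l (ε-0 (suc l))))) (+-identityʳ _))
  G-recursion ε-0 zero    (suc b) = sym (trans (+-congˡ (Sums.Σ<-zero S r (λ l _ → signed-zero l (ε-0 (suc l))))) (+-identityʳ _))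
  G-recursion ε-0 (suc J) zero    = sym (+-identityˡ _)
  G-recursion ε-0 (suc J) (suc b) = G-recursion ε-0 J b

-- Comparing coefficients in
--   T^j = Σ_{i<r} H_i·Tⁱ + Q·S
-- gives, for n < r,  0 = H_n + (Q·S)_n, and for n ≥ r,  δ_{nj} = (Q·S)_n.
-- Since Q is monic with the coefficients of Vieta, the second family says
-- that the coefficients of S satisfy the recursion of G J; as S has
-- finite support, a downward induction shows S_b = G J b for all b, and
-- then the first family gives H_n = Hexpr J n.

module Remainder {c ℓ} (A : CommutativeRing c ℓ) (r : ℕ) where
  open Polynomials A
  open ElementarySymmetric A
  open Vieta A r
  open Signs R
  open SetoidReasoning R.setoid

  open Recurrence R r (λ l x → esym l R.* x) public

  Tⁱ : ℕ → RT.Coeffs 1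
  Tⁱ = powA RTᵒ T

  remainderPart : (Fin r → R.Carrier) → RT.Coeffs 1
  remainderPart H = sumA RTᵒ (Vec.toList (Vec.map (λ i → RingOps._*_ RTᵒ (const Rᵒ (H i)) (Tⁱ (toℕ i))) (Vec.allFin r)))

  IsDivision : ℕ → (Fin r → R.Carrier) → RT.Coeffs 1 → Set ℓ
  IsDivision j H S = RT.P._≈_ 1 (Tⁱ j) (RingOps._+_ RTᵒ (remainderPart H) (RingOps._*_ RTᵒ Q S))

  private
    sumR : List R.Carrier → R.Carrier
    sumR = foldr R._+_ R.0#

    sumFin-zero : ∀ k (g : Fin k → Fin r) (θ : Fin r → R.Carrier) → (∀ i → θ (g i) R.≈ R.0#) →
      sumR (Vec.toList (Vec.map θ (Vec.tabulate g))) R.≈ R.0#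
    sumFin-zero zero    g θ h = R.refl
    sumFin-zero (suc k) g θ h = R.trans (R.+-cong (h Fin.zero) (sumFin-zero k (g ∘ Fin.suc) θ (h ∘ Fin.suc))) (R.+-identityˡ _)

    sumFin-single : ∀ k (g : Fin k → Fin r) (θ : Fin r → R.Carrier) i₀ → (∀ i → ¬ i ≡ i₀ → θ (g i) R.≈ R.0#) →
      sumR (Vec.toList (Vec.map θ (Vec.tabulate g))) R.≈ θ (g i₀)
    sumFin-single (suc k) g θ Fin.zero      h =
      R.trans (R.+-congˡ (sumFin-zero k (g ∘ Fin.suc) θ (λ i → h (Fin.suc i) (λ ())))) (R.+-identityʳ _)
    sumFin-single (suc k) g θ (Fin.suc i₀) h = R.trans (R.+-congʳ (h Fin.zero (λ ()))) (R.trans (R.+-identityˡ _)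
      (sumFin-single k (g ∘ Fin.suc) θ i₀ (λ i ne → h (Fin.suc i) (ne ∘ FinP.suc-injective))))

    map-at : ∀ {k} (ψ : Fin r → RT.Coeffs 1) e (V : Vec (Fin r) k) →
      map (λ f → f e) (Vec.toList (Vec.map ψ V)) ≡ Vec.toList (Vec.map (λ i → ψ i e) V)
    map-at ψ e []      = Eq.refl
    map-at ψ e (x ∷ V) = Eq.cong (ψ x e ∷_) (map-at ψ e V)

  module CoefficientComparison (j : ℕ) (H : Fin r → R.Carrier) (S : RT.Coeffs 1) (div : IsDivision j H S) where

    q s : ℕ → R.Carrier
    q = RT.coeff Q
    s = RT.coeff S

    private
      term : Fin r → RT.Coeffs 1
      term i = RingOps._*_ RTᵒ (const Rᵒ (H i)) (Tⁱ (toℕ i))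

      term-coeff : ∀ n i → RT.coeff (term i) n R.≈ H i R.* ΣR.δ n (toℕ i)
      term-coeff n i = R.trans (RT.const-* 1 (H i) _ (n ∷ [])) (R.*-congˡ (RT.coeff-Tᵢ (toℕ i) n))

      coefficient : ∀ n → ΣR.δ n j R.≈ sumR (Vec.toList (Vec.map (λ i → RT.coeff (term i) n) (Vec.allFin r))) R.+ ΣR.conv q s n
      coefficient n = R.trans (R.sym (RT.coeff-Tᵢ j n)) (R.trans (div (n ∷ []))
        (R.+-cong (R.reflexive (Eq.trans (RT.sumA-at 1 (Vec.toList (Vec.map term (Vec.allFin r))) (n ∷ []))
                                         (Eq.cong sumR (map-at term (n ∷ []) (Vec.allFin r)))))
                  (RT.coeff-* Q S n)))

    low-coefficients : ∀ (i : Fin r) → toℕ i < j → R.0# R.≈ H i R.+ ΣR.conv q s (toℕ i)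
    low-coefficients i₀ lt = R.trans (R.sym (ΣR.δ-off (toℕ i₀) j (λ e → ℕP.<-irrefl e lt))) (R.trans (coefficient (toℕ i₀))
      (R.+-congʳ (R.trans (sumFin-single r (λ i → i) (λ i → RT.coeff (term i) (toℕ i₀)) i₀
          (λ i ne → R.trans (term-coeff (toℕ i₀) i)
            (R.trans (R.*-congˡ (ΣR.δ-off (toℕ i₀) (toℕ i) (λ e → ne (FinP.toℕ-injective (Eq.sym e))))) (R.zeroʳ _))))
        (R.trans (term-coeff (toℕ i₀) i₀) (R.trans (R.*-congˡ (ΣR.δ-diag (toℕ i₀))) (R.*-identityʳ _))))))

    high-coefficients : ∀ n → r ≤ n → ΣR.δ n j R.≈ ΣR.conv q s n
    high-coefficients n r≤n = R.trans (coefficient n) (R.trans (R.+-congʳ (sumFin-zero r (λ i → i) (λ i → RT.coeff (term i) n)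
        (λ i → R.trans (term-coeff n i) (R.trans (R.*-congˡ (ΣR.δ-off n (toℕ i)
          (λ e → ℕP.<-irrefl (Eq.sym e) (ℕP.<-≤-trans (FinP.toℕ<n i) r≤n)))) (R.zeroʳ _)))))
      (R.+-identityˡ _))

  module Quotient (J : ℕ) (H : Fin r → R.Carrier) (S : RT.Coeffs 1) (div : IsDivision (J ℕ.+ r) H S)
                  (N : ℕ) (S-bounded : ∀ b → N < b → RT.coeff S b R.≈ R.0#) where
    open CoefficientComparison (J ℕ.+ r) H S div

    q-≤ : ∀ a → a ≤ r → q a R.≈ signed (r ∸ a) (esym (r ∸ a))
    q-≤ a a≤r = R.trans (Q-coeff a) (R.reflexive (vietaCoeff-≤ 0 r a a≤r))

    q-top : q r R.≈ R.1#
    q-top = R.trans (q-≤ r ℕP.≤-refl)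
      (λ e → A.trans (A.reflexive (Eq.cong (λ t → signed t (esym t) e) (ℕP.n∸n≡0 r))) (esym-0 r e))

    q-below : ∀ l → suc l ≤ r → q (r ∸ suc l) R.≈ R.- signed l (esym (suc l))
    q-below l l<r = R.trans (q-≤ (r ∸ suc l) (ℕP.m∸n≤m r (suc l)))
      (R.reflexive (Eq.cong (λ t → signed t (esym t)) (ℕP.m∸[m∸n]≡n l<r)))

    q-above : ∀ a → r < a → q a R.≈ R.0#
    q-above a r<a = R.trans (Q-coeff a) (R.reflexive (vietaCoeff-> 0 r a r<a))

    tailSum : ℕ → R.Carrier
    tailSum b = ΣR.Σ< r (λ l → signed l (esym (suc l) R.* s (b ℕ.+ suc l)))

    QS-coeff : ∀ b → ΣR.conv q s (b ℕ.+ r) R.≈ s b R.+ R.- tailSum b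
    QS-coeff b = begin
      ΣR.conv q s (b ℕ.+ r)       ≈⟨ ΣR.conv-comm (b ℕ.+ r) q s ⟩
      ΣR.Σ< (suc (b ℕ.+ r)) φ     ≡⟨ Eq.cong (λ t → ΣR.Σ< t φ) (Eq.sym (ℕP.+-suc b r)) ⟩
      ΣR.Σ< (b ℕ.+ suc r) φ       ≈⟨ ΣR.Σ<-split b (suc r) φ ⟩
      ΣR.Σ< b φ R.+ (φ (b ℕ.+ 0) R.+ ΣR.Σ< r (λ l → φ (b ℕ.+ suc l)))
        ≈⟨ R.+-cong (ΣR.Σ<-zero b (λ a a<b → R.trans (R.*-congˡ (q-above _ (above a a<b))) (R.zeroʳ _)))
                    (R.+-cong middle (ΣR.Σ<-cong r below)) ⟩
      R.0# R.+ (s b R.+ ΣR.Σ< r (λ l → R.- signed l (esym (suc l) R.* s (b ℕ.+ suc l))))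
        ≈⟨ R.+-identityˡ _ ⟩
      s b R.+ ΣR.Σ< r (λ l → R.- signed l (esym (suc l) R.* s (b ℕ.+ suc l)))
        ≈⟨ R.+-congˡ (ΣR.Σ<-neg r _) ⟩
      s b R.+ R.- tailSum b       ∎
      where
      φ : ℕ → R.Carrier
      φ a = s a R.* q (b ℕ.+ r ∸ a)
      -- terms a < b meet coefficients of Q above degree r
      above : ∀ a → a < b → r < b ℕ.+ r ∸ a
      above a a<b = ℕP.<-≤-trans (ℕP.m<n+m r (ℕP.m<n⇒0<n∸m a<b))
                                 (ℕP.≤-reflexive (Eq.sym (ℕP.+-∸-comm r (ℕP.<⇒≤ a<b))))
      -- the term a = b meets the leading coefficient 1
      middle : φ (b ℕ.+ 0) R.≈ s b
      middle = R.trans (R.reflexive (Eq.cong₂ (λ x y → s x R.* q y) (ℕP.+-identityʳ b)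
                         (Eq.trans (Eq.cong (b ℕ.+ r ∸_) (ℕP.+-identityʳ b)) (ℕP.m+n∸m≡n b r))))
                       (R.trans (R.*-congˡ q-top) (R.*-identityʳ _))
      below : ∀ l → l < r → φ (b ℕ.+ suc l) R.≈ R.- signed l (esym (suc l) R.* s (b ℕ.+ suc l))
      below l l<r = begin
        s (b ℕ.+ suc l) R.* q (b ℕ.+ r ∸ (b ℕ.+ suc l))
          ≡⟨ Eq.cong (λ t → s (b ℕ.+ suc l) R.* q t) (ℕP.[m+n]∸[m+o]≡n∸o b r (suc l)) ⟩
        s (b ℕ.+ suc l) R.* q (r ∸ suc l)                ≈⟨ R.*-congˡ (q-below l l<r) ⟩
        s (b ℕ.+ suc l) R.* R.- signed l (esym (suc l))  ≈⟨ R.sym (RP.-‿distribʳ-* _ _) ⟩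
        R.- (s (b ℕ.+ suc l) R.* signed l (esym (suc l))) ≈⟨ R.-‿cong (R.*-comm _ _) ⟩
        R.- (signed l (esym (suc l)) R.* s (b ℕ.+ suc l)) ≈⟨ R.-‿cong (R.sym (signed-*ˡ l _ _)) ⟩
        R.- signed l (esym (suc l) R.* s (b ℕ.+ suc l))   ∎

    S-recursion : ∀ b → s b R.≈ ΣR.δ b J R.+ tailSum b
    S-recursion b = begin
      s b                                 ≈⟨ R.sym (R.+-identityʳ _) ⟩
      s b R.+ R.0#                        ≈⟨ R.+-congˡ (R.sym (R.-‿inverseˡ _)) ⟩
      s b R.+ (R.- tailSum b R.+ tailSum b) ≈⟨ R.sym (R.+-assoc _ _ _) ⟩
      (s b R.+ R.- tailSum b) R.+ tailSum b ≈⟨ R.+-congʳ (R.sym (QS-coeff b)) ⟩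
      ΣR.conv q s (b ℕ.+ r) R.+ tailSum b ≈⟨ R.+-congʳ (R.sym (high-coefficients (b ℕ.+ r) (ℕP.m≤n+m r b))) ⟩
      ΣR.δ (b ℕ.+ r) (J ℕ.+ r) R.+ tailSum b
        ≡⟨ Eq.cong (R._+ tailSum b) (Eq.trans (Eq.cong₂ ΣR.δ (ℕP.+-comm b r) (ℕP.+-comm J r)) (ΣR.δ-+ˡ r b J)) ⟩
      ΣR.δ b J R.+ tailSum b              ∎

    -- uniqueness: both sequences vanish far out and satisfy the same
    -- recursion, so they agree, by downward induction from the bound
    S≈G : ∀ b → s b R.≈ G J b
    S≈G b = agree M b (ℕP.m≤n+m M b)
      where
      M : ℕ
      M = suc (N ℕ.+ J)
      agree : ∀ d b → M ≤ b ℕ.+ d → s b R.≈ G J b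
      agree zero    b le = R.trans (S-bounded b (ℕP.<-≤-trans (s≤s (ℕP.m≤m+n N J)) M≤b))
          (R.reflexive (Eq.sym (G-beyond J b (ℕP.<-≤-trans (s≤s (ℕP.m≤n+m J N)) M≤b))))
        where
        M≤b : M ≤ b
        M≤b = Eq.subst (M ≤_) (ℕP.+-identityʳ b) le
      agree (suc d) b le = begin
        s b                                  ≈⟨ S-recursion b ⟩
        ΣR.δ b J R.+ tailSum b
          ≈⟨ R.+-congˡ (ΣR.Σ<-cong r (λ l _ → signed-cong l (R.*-congˡ (agree d (b ℕ.+ suc l) (further l))))) ⟩
        ΣR.δ b J R.+ ΣR.Σ< r (λ l → signed l (esym (suc l) R.* G J (b ℕ.+ suc l)))
          ≈⟨ R.sym (G-recursion (λ l → R.zeroʳ (esym l)) J b) ⟩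
        G J b                                ∎
        where
        further : ∀ l → M ≤ (b ℕ.+ suc l) ℕ.+ d
        further l = ℕP.≤-trans le (ℕP.≤-trans (ℕP.+-monoʳ-≤ b (s≤s (ℕP.m≤n+m d l)))
                                              (ℕP.≤-reflexive (Eq.sym (ℕP.+-assoc b (suc l) d))))

    H≈Hexpr : ∀ (i : Fin r) → H i R.≈ Hexpr J (toℕ i)
    H≈Hexpr i = begin
      H i                           ≈⟨ RP.+-inverseˡ-unique _ _ (R.sym (low-coefficients i (ℕP.<-≤-trans (FinP.toℕ<n i) (ℕP.m≤n+m r J)))) ⟩
      R.- ΣR.conv q s n             ≈⟨ R.-‿cong (ΣR.conv-cong {q} {q} (λ a → R.refl) S≈G n) ⟩
      R.- ΣR.conv q (G J) n         ≈⟨ R.-‿cong (ΣR.Σ<-cong (suc n) term) ⟩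
      Hexpr J n                     ∎
      where
      n = toℕ i
      term : ∀ a → a < suc n → q a R.* G J (n ∸ a) R.≈ signed (r ∸ a) (esym (r ∸ a) R.* G J (n ∸ a))
      term a (s≤s a≤n) = R.trans (R.*-congʳ (q-≤ a (ℕP.≤-trans a≤n (ℕP.<⇒≤ (FinP.toℕ<n i)))))
                                 (R.sym (signed-*ˡ (r ∸ a) _ _))

  -- Homogeneity.  G J b is homogeneous of degree J - b, and the term a of
  -- Hexpr J n of degree (r - a) + (J - (n - a)) = J + r - n.
  open Vanishing A

  G-homogeneous : ∀ J b → b ≤ J → IsHom (J ∸ b) (G J b)
  G-homogeneous zero    zero    _        = hom-1 r
  G-homogeneous (suc J) (suc b) (s≤s le) = G-homogeneous J b le
  G-homogeneous (suc J) zero    _        = vanishes-ΣP r _ term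
    where
    term : ∀ l → l < r → IsHom (suc J) (signed l (esym (suc l) R.* G J l))
    term l _ with l ℕP.≤? J
    ... | yes l≤J = vanishes-signed l
          (Eq.subst (λ d → IsHom d (esym (suc l) R.* G J l)) (Eq.cong suc (ℕP.m+[n∸m]≡n l≤J))
                    (hom-* (hom-esym (suc l)) (G-homogeneous J l l≤J)))
    ... | no  l≰J = vanishes-0 (signed-zero l (R.trans (R.*-congˡ (R.reflexive (G-beyond J l (ℕP.≰⇒> l≰J)))) (R.zeroʳ _)))

  Hexpr-homogeneous : ∀ J n → n < r → IsHom (J ℕ.+ r ∸ n) (Hexpr J n)
  Hexpr-homogeneous J n n<r = vanishes-neg (vanishes-ΣP (suc n) _ term)
    where
    term : ∀ a → a < suc n → IsHom (J ℕ.+ r ∸ n) (signed (r ∸ a) (esym (r ∸ a) R.* G J (n ∸ a)))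
    term a (s≤s a≤n) with (n ∸ a) ℕP.≤? J
    ... | yes le = vanishes-signed (r ∸ a)
          (Eq.subst (λ d → IsHom d (esym (r ∸ a) R.* G J (n ∸ a))) (term-degree r J n a a≤n n<r le)
                    (hom-* (hom-esym (r ∸ a)) (G-homogeneous J (n ∸ a) le)))
    ... | no  ≰J = vanishes-0 (signed-zero (r ∸ a)
          (R.trans (R.*-congˡ (R.reflexive (G-beyond J (n ∸ a) (ℕP.≰⇒> ≰J)))) (R.zeroʳ _)))

-- Defs sums over the box of
-- exponent vectors with entries ≤ N; `evaluate` is the same sum with a
-- named monomial function.

module Evaluation {c ℓ} (A B : CommutativeRing c ℓ) (ι : CommutativeRing.Carrier A → CommutativeRing.Carrier B)
                  (ι-hom : IsRingHomomorphism (CommutativeRing.rawRing A) (CommutativeRing.rawRing B) ι) where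
  open Polynomials A
  module B = CommutativeRing B
  module BP = RingProperties B.ring
  module ΣB = Sums B
  module ι = IsRingHomomorphism ι-hom
  open SetoidReasoning B.setoid

  pow : B.Carrier → ℕ → B.Carrier
  pow x zero    = B.1#
  pow x (suc m) = x B.* pow x m

  monomial : ∀ {n} → (Fin n → B.Carrier) → Vec ℕ n → B.Carrier
  monomial w []      = B.1#
  monomial w (x ∷ e) = pow (w Fin.zero) x B.* monomial (w ∘ Fin.suc) e

  evaluate : ∀ {n} → ℕ → Coeffs n → (Fin n → B.Carrier) → B.Carrier
  evaluate {n} N P v = ΣB.sumList (map (λ e → ι (P e) B.* monomial v e) (box N n))

  -- Defs computes powers by a local function; any function obeying the
  -- defining equations of powers gives the same monomials
  evaluate≡eval : ∀ {n} N P v → eval Aᵒ (ringOps B) ι {n} N P v ≡ evaluate N P v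
  evaluate≡eval {n} N P v =
    Eq.cong ΣB.sumList (ListP.map-cong (λ e → Eq.cong (ι (P e) B.*_) (same-monomial _ (λ _ → Eq.refl) (λ _ _ → Eq.refl) n v e)) (box N n))
    where
    same-monomial : (pw : B.Carrier → ℕ → B.Carrier) → (∀ x → pw x 0 ≡ B.1#) → (∀ x m → pw x (suc m) ≡ x B.* pw x m) →
      ∀ n (w : Fin n → B.Carrier) e →
      foldr B._*_ B.1# (Vec.toList (Vec.zipWith (λ x m → pw x m) (Vec.tabulate w) e)) ≡ monomial w e
    same-monomial pw pw-0 pw-suc zero    w []      = Eq.refl
    same-monomial pw pw-0 pw-suc (suc n) w (x ∷ e) = Eq.cong₂ B._*_ (same-pow x) (same-monomial pw pw-0 pw-suc n _ e)
      where
      same-pow : ∀ m → pw (w Fin.zero) m ≡ pow (w Fin.zero) m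
      same-pow zero    = pw-0 _
      same-pow (suc m) = Eq.trans (pw-suc _ m) (Eq.cong (w Fin.zero B.*_) (same-pow m))

  module _ {n : ℕ} (N : ℕ) (v : Fin n → B.Carrier) where

    evaluate-cong : ∀ {P P′ : Coeffs n} → P._≈_ n P P′ → evaluate N P v B.≈ evaluate N P′ v
    evaluate-cong eq = ΣB.sumList-cong (box N n) (λ e → B.*-congʳ (ι.⟦⟧-cong (eq e)))

    evaluate-zero : ∀ (P : Coeffs n) → (∀ e → P e A.≈ A.0#) → evaluate N P v B.≈ B.0#
    evaluate-zero P z = ΣB.sumList-zero _ (box N n) (λ e → B.trans (B.*-congʳ (B.trans (ι.⟦⟧-cong (z e)) ι.0#-homo)) (B.zeroˡ _))

    evaluate-+ : ∀ (P P′ : Coeffs n) → evaluate N (P._+_ n P P′) v B.≈ evaluate N P v B.+ evaluate N P′ v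
    evaluate-+ P P′ = B.trans (ΣB.sumList-cong (box N n) (λ e → B.trans (B.*-congʳ (ι.+-homo (P e) (P′ e))) (B.distribʳ _ _ _)))
                              (ΣB.sumList-+ _ _ (box N n))

    evaluate-scale : ∀ k (P : Coeffs n) → evaluate N (scale k P) v B.≈ ι k B.* evaluate N P v
    evaluate-scale k P = B.trans (ΣB.sumList-cong (box N n) (λ e → B.trans (B.*-congʳ (ι.*-homo k (P e))) (B.*-assoc _ _ _)))
                                 (ΣB.sumList-*ˡ _ _ (box N n))

    evaluate-neg : ∀ (P : Coeffs n) → evaluate N (P.-_ n P) v B.≈ B.- evaluate N P v
    evaluate-neg P = B.trans (ΣB.sumList-cong (box N n) (λ e → B.trans (B.*-congʳ (ι.-‿homo (P e))) (B.sym (BP.-‿distribˡ-* _ _))))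
      (B.trans (ΣB.sumList-cong (box N n) (λ e → B.sym (BP.-1*x≈-x _)))
               (B.trans (ΣB.sumList-*ˡ (B.- B.1#) _ (box N n)) (BP.-1*x≈-x _)))

    evaluate-ΣP : ∀ k (ψ : ℕ → Coeffs n) → evaluate N (ΣP n k ψ) v B.≈ ΣB.Σ< k (λ a → evaluate N (ψ a) v)
    evaluate-ΣP zero    ψ = evaluate-zero _ (λ e → A.refl)
    evaluate-ΣP (suc k) ψ = B.trans (evaluate-+ (ψ 0) _) (B.+-congˡ (evaluate-ΣP k (ψ ∘ suc)))

    evaluate-signed : ∀ t (P : Coeffs n) → evaluate N (Signs.signed (PolyRing n) t P) v B.≈ Signs.signed B t (evaluate N P v)
    evaluate-signed zero    P = B.refl
    evaluate-signed (suc t) P = B.trans (evaluate-neg (Signs.signed (PolyRing n) t P)) (B.-‿cong (evaluate-signed t P))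

  swap : ∀ x y z → x B.* (y B.* z) B.≈ y B.* (x B.* z)
  swap x y z = B.trans (B.sym (B.*-assoc x y z)) (B.trans (B.*-congʳ (B.*-comm x y)) (B.*-assoc y x z))

  horner : ∀ {n} N (P : Coeffs (suc n)) (v : Fin (suc n) → B.Carrier) →
    evaluate N P v B.≈ ΣB.Σ< (suc N) (λ a → pow (v Fin.zero) a B.* evaluate N (curry P a) (v ∘ Fin.suc))
  horner {n} N P v = B.trans (ΣB.sumList-concatMap F (λ a → map (a ∷_) (box N n)) (upTo (suc N)))
      (B.trans (B.reflexive (ΣB.sumList-upTo _ (suc N))) (ΣB.Σ<-cong (suc N) row))
    where
    F : Vec ℕ (suc n) → B.Carrier
    F e = ι (P e) B.* monomial v e
    row : ∀ a → a < suc N → ΣB.sumList (map F (map (a ∷_) (box N n))) B.≈ pow (v Fin.zero) a B.* evaluate N (curry P a) (v ∘ Fin.suc)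
    row a _ = B.trans (B.reflexive (Eq.cong ΣB.sumList (Eq.sym (ListP.map-∘ {g = F} {f = a ∷_} (box N n)))))
      (B.trans (ΣB.sumList-cong (box N n) (λ e → swap _ _ _)) (ΣB.sumList-*ˡ _ _ (box N n)))

  evaluate-1 : ∀ n N (v : Fin n → B.Carrier) → evaluate N (P.1# n) v B.≈ B.1#
  evaluate-1 zero    N v = B.trans (B.+-identityʳ _) (B.trans (B.*-identityʳ _)
                             (B.trans (ι.⟦⟧-cong (1-at-origin 0 [] Eq.refl)) ι.1#-homo))
  evaluate-1 (suc n) N v = B.trans (horner N (P.1# (suc n)) v)
    (B.trans (B.+-cong (B.trans (B.*-identityˡ _) (B.trans (evaluate-cong N (v ∘ Fin.suc) (1-head-zero n)) (evaluate-1 n N (v ∘ Fin.suc))))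
                       (ΣB.Σ<-zero N (λ a _ → B.trans (B.*-congˡ (evaluate-zero N (v ∘ Fin.suc) _ (1-head-suc n a))) (B.zeroʳ _))))
             (B.+-identityʳ _))

  -- evaluation of Y_{p+1}·P, when the box N contains the support of the product
  evaluate-mulVar : ∀ n p (w : ℕ → B.Carrier) (P : Coeffs n) D N → p < n → IsPolyBound Aᵒ D P → D < N →
    evaluate N (mulVar p P) (w ∘ toℕ) B.≈ w p B.* evaluate N P (w ∘ toℕ)
  evaluate-mulVar (suc n) zero w P D N _ P-bounded D<N = begin
    evaluate N (mulVar 0 P) (w ∘ toℕ)
      ≈⟨ horner N (mulVar 0 P) (w ∘ toℕ) ⟩
    pow x 0 B.* evaluate N (λ e → A.0#) v′ B.+ ΣB.Σ< N (λ a → (x B.* pow x a) B.* evaluate N (curry P a) v′)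
      ≈⟨ B.+-cong (B.trans (B.*-congˡ (evaluate-zero N v′ _ (λ e → A.refl))) (B.zeroʳ _))
                  (ΣB.Σ<-cong N (λ a _ → B.*-assoc x (pow x a) (evaluate N (curry P a) v′))) ⟩
    B.0# B.+ ΣB.Σ< N (λ a → x B.* φ a)    ≈⟨ B.+-identityˡ _ ⟩
    ΣB.Σ< N (λ a → x B.* φ a)             ≈⟨ B.sym (ΣB.Σ<-*ˡ N x φ) ⟩
    x B.* ΣB.Σ< N φ                       ≈⟨ B.*-congˡ (B.sym (B.trans (ΣB.Σ<-last N φ) (B.trans (B.+-congˡ top-vanishes) (B.+-identityʳ _)))) ⟩
    x B.* ΣB.Σ< (suc N) φ                 ≈⟨ B.*-congˡ (B.sym (horner N P (w ∘ toℕ))) ⟩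
    w 0 B.* evaluate N P (w ∘ toℕ)        ∎
    where
    x = w 0
    v′ : Fin n → B.Carrier
    v′ = (w ∘ toℕ) ∘ Fin.suc
    φ : ℕ → B.Carrier
    φ a = pow x a B.* evaluate N (curry P a) v′
    -- Y₁ᴺ does not occur in P, since D < N
    top-vanishes : φ N B.≈ B.0#
    top-vanishes = B.trans (B.*-congˡ (evaluate-zero N v′ _ (λ e → P-bounded (N ∷ e) (ℕP.<-≤-trans D<N (ℕP.m≤m+n N (deg e))))))
                           (B.zeroʳ _)
  evaluate-mulVar (suc n) (suc p) w P D N (s≤s p<n) P-bounded D<N = begin
    evaluate N (mulVar (suc p) P) (w ∘ toℕ)
      ≈⟨ horner N (mulVar (suc p) P) (w ∘ toℕ) ⟩
    ΣB.Σ< (suc N) (λ a → pow (w 0) a B.* evaluate N (mulVar p (curry P a)) v′)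
      ≈⟨ ΣB.Σ<-cong (suc N) (λ a _ → B.*-congˡ {pow (w 0) a} (evaluate-mulVar n p (w ∘ suc) (curry P a) D N p<n
            (λ e lt → P-bounded (a ∷ e) (ℕP.<-≤-trans lt (ℕP.m≤n+m (deg e) a))) D<N)) ⟩
    ΣB.Σ< (suc N) (λ a → pow (w 0) a B.* (w (suc p) B.* evaluate N (curry P a) v′))
      ≈⟨ ΣB.Σ<-cong (suc N) (λ a _ → swap (pow (w 0) a) (w (suc p)) (evaluate N (curry P a) v′)) ⟩
    ΣB.Σ< (suc N) (λ a → w (suc p) B.* φ a)
      ≈⟨ B.sym (ΣB.Σ<-*ˡ (suc N) (w (suc p)) φ) ⟩
    w (suc p) B.* ΣB.Σ< (suc N) (λ a → pow (w 0) a B.* evaluate N (curry P a) v′)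
      ≈⟨ B.*-congˡ (B.sym (horner N P (w ∘ toℕ))) ⟩
    w (suc p) B.* evaluate N P (w ∘ toℕ) ∎
    where
    v′ : Fin n → B.Carrier
    v′ = (w ∘ suc) ∘ toℕ
    φ : ℕ → B.Carrier
    φ a = pow (w 0) a B.* evaluate N (curry P a) v′

-- Running the
-- recursion in A[Y₁,…,Y_m] with ε_l = Y_l·(-) produces polynomials
-- Y.G, Y.Hexpr; evaluating at Y_l = e_l (a ring map sending Y_l·(-) to
-- e_l·(-)) gives back G and Hexpr.  When m = J + r - n ≤ r, the only
-- term of Y.Hexpr J n containing the last variable Y_m is the one with
-- r - a = m, which equals (-1)^m·Y_m·G J J = (-1)^m·Y_m: so ±Y.Hexpr J n
-- is Y_m plus a polynomial in Y₁,…,Y_{m-1}.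

module InTermsOfΠ {c ℓ} (A : CommutativeRing c ℓ) (r k : ℕ)
                  (w : ℕ → CommutativeRing.Carrier (Polynomials.PolyRing A r))
                  (w≈esym : ∀ p → CommutativeRing._≈_ (Polynomials.PolyRing A r) (w p) (ElementarySymmetric.esym A (suc p)))
                  where
  open Polynomials A
  open Vanishing A
  open Remainder A r using (G; Hexpr; G-beyond)
  open Signs A using () renaming (signed to signedA; signed-zero to signedA-zero)

  R : CommutativeRing c ℓ
  R = PolyRing r
  module R = CommutativeRing R
  module ΣR = Sums R
  open Signs R using (signed; signed-cong; signed-zero)
  open Evaluation A R (const Aᵒ) (const-isRingHomomorphism r)

  m : ℕ
  m = suc k

  module Y = Recurrence (PolyRing m) r (λ l → mulVar (ℕ.pred l))

  v : Fin m → R.Carrier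
  v = w ∘ toℕ

  signed-at : ∀ t (f : Coeffs m) e → Signs.signed (PolyRing m) t f e ≡ signedA t (f e)
  signed-at zero    f e = Eq.refl
  signed-at (suc t) f e = Eq.cong A.-_ (signed-at t f e)

  YG-bounded : ∀ T l → Bounded T (Y.G T l)
  YG-bounded zero    zero    = bounded-1 m
  YG-bounded zero    (suc l) = vanishes-0 (λ e → A.refl)
  YG-bounded (suc T) zero    = vanishes-ΣP r _ (λ l _ → vanishes-signed l (bounded-mulVar l (YG-bounded T l)))
  YG-bounded (suc T) (suc l) = bounded-mono (ℕP.n≤1+n T) (YG-bounded T l)

  YG-evaluates : ∀ T → T < m → ∀ l → evaluate m (Y.G T l) v R.≈ G T l
  YG-evaluates zero    _  zero    = evaluate-1 m m v
  YG-evaluates zero    _  (suc l) = evaluate-zero m v _ (λ e → A.refl)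
  YG-evaluates (suc T) lt (suc l) = YG-evaluates T (ℕP.<-trans (ℕP.n<1+n T) lt) l
  YG-evaluates (suc T) lt zero    = R.trans (evaluate-ΣP m v r _) (ΣR.Σ<-cong r term)
    where
    T<m = ℕP.<-trans (ℕP.n<1+n T) lt
    term : ∀ l → l < r → evaluate m (Signs.signed (PolyRing m) l (mulVar l (Y.G T l))) v
                         R.≈ signed l (ElementarySymmetric.esym A (suc l) R.* G T l)
    term l _ with l ℕP.≤? T
    ... | yes l≤T = R.trans (evaluate-signed m v l _) (signed-cong l (R.trans
            (evaluate-mulVar m l w (Y.G T l) T m (ℕP.≤-<-trans l≤T T<m) (YG-bounded T l) T<m)
            (R.*-cong (w≈esym l) (YG-evaluates T T<m l))))
    ... | no  l≰T = R.trans (evaluate-signed m v l _) (signed-cong l (R.trans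
            (evaluate-zero m v _ (mulVar-zero l (λ e → A.reflexive (Eq.cong (λ z → z e) (Y.G-beyond T l (ℕP.≰⇒> l≰T))))))
            (R.sym (R.trans (R.*-congˡ (R.reflexive (G-beyond T l (ℕP.≰⇒> l≰T)))) (R.zeroʳ _)))))

  YG-noLast : ∀ T → T ≤ k → ∀ l → NoLast (Y.G T l)
  YG-noLast zero    _  zero    = noLast-1 k
  YG-noLast zero    _  (suc l) = λ rest x → A.refl
  YG-noLast (suc T) le (suc l) = YG-noLast T (ℕP.<⇒≤ le) l
  YG-noLast (suc T) le zero    = noLast-ΣP r _ term
    where
    term : ∀ l → l < r → NoLast (Signs.signed (PolyRing m) l (mulVar l (Y.G T l)))
    term l _ with l ℕP.≤? T
    ... | yes l≤T = noLast-signed l (noLast-mulVar l (ℕP.≤-<-trans l≤T le) (YG-noLast T (ℕP.<⇒≤ le) l))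
    ... | no  l≰T = noLast-signed l (λ rest x →
            mulVar-zero l (λ e → A.reflexive (Eq.cong (λ z → z e) (Y.G-beyond T l (ℕP.≰⇒> l≰T)))) (rest ∷ʳ suc x))

  module Coefficient (J n : ℕ) (n<r : n < r) (m≡ : m ≡ J ℕ.+ r ∸ n) where

    J<m : J < m
    J<m = Eq.subst (J <_) (Eq.sym m≡) (Eq.subst (J <_) (Eq.sym (ℕP.+-∸-assoc J (ℕP.<⇒≤ n<r)))
            (ℕP.m<m+n J (ℕP.m<n⇒0<n∸m n<r)))

    term : ℕ → Coeffs m
    term a = Signs.signed (PolyRing m) (r ∸ a) (mulVar (ℕ.pred (r ∸ a)) (Y.G J (n ∸ a)))

    r∸a-positive : ∀ a → a ≤ n → 0 < r ∸ a
    r∸a-positive a a≤n = ℕP.m<n⇒0<n∸m (ℕP.≤-<-trans a≤n n<r)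

    suc-pred : ∀ t → 0 < t → suc (ℕ.pred t) ≡ t
    suc-pred (suc t) _ = Eq.refl

    term-degree′ : ∀ a → a ≤ n → n ∸ a ≤ J → (r ∸ a) ℕ.+ (J ∸ (n ∸ a)) ≡ m
    term-degree′ a a≤n le = Eq.trans (term-degree r J n a a≤n n<r le) (Eq.sym m≡)

    YH-evaluates : evaluate m (Y.Hexpr J n) v R.≈ Hexpr J n
    YH-evaluates = R.trans (evaluate-neg m v _) (R.-‿cong (R.trans (evaluate-ΣP m v (suc n) term) (ΣR.Σ<-cong (suc n) term-evaluates)))
      where
      term-evaluates : ∀ a → a < suc n →
        evaluate m (term a) v R.≈ signed (r ∸ a) (ElementarySymmetric.esym A (r ∸ a) R.* G J (n ∸ a))
      term-evaluates a (s≤s a≤n) with (n ∸ a) ℕP.≤? J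
      ... | yes le = R.trans (evaluate-signed m v (r ∸ a) _) (signed-cong (r ∸ a) (R.trans
              (evaluate-mulVar m (ℕ.pred (r ∸ a)) w _ J m pred<m (YG-bounded J (n ∸ a)) J<m)
              (R.*-cong (R.trans (w≈esym _) (R.reflexive (Eq.cong (ElementarySymmetric.esym A) (suc-pred (r ∸ a) (r∸a-positive a a≤n)))))
                        (YG-evaluates J J<m (n ∸ a)))))
        where
        pred<m : ℕ.pred (r ∸ a) < m
        pred<m = ℕP.<-≤-trans (ℕP.≤-reflexive (suc-pred (r ∸ a) (r∸a-positive a a≤n)))
                   (Eq.subst (r ∸ a ≤_) (term-degree′ a a≤n le) (ℕP.m≤m+n (r ∸ a) _))
      ... | no  ≰J = R.trans (evaluate-signed m v (r ∸ a) _) (signed-cong (r ∸ a) (R.trans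
              (evaluate-zero m v _ (mulVar-zero _ (λ e → A.reflexive (Eq.cong (λ z → z e) (Y.G-beyond J (n ∸ a) (ℕP.≰⇒> ≰J))))))
              (R.sym (R.trans (R.*-congˡ (R.reflexive (G-beyond J (n ∸ a) (ℕP.≰⇒> ≰J)))) (R.zeroʳ _)))))

    YH-bounded : Bounded m (Y.Hexpr J n)
    YH-bounded = bounded-mono J<m (vanishes-neg (vanishes-ΣP (suc n) term
      (λ a _ → vanishes-signed (r ∸ a) (bounded-mulVar (ℕ.pred (r ∸ a)) (YG-bounded J (n ∸ a))))))

    J≤n : m ≤ r → J ≤ n
    J≤n m≤r = ℕP.+-cancelʳ-≤ (r ∸ n) J n (begin
      J ℕ.+ (r ∸ n)  ≡⟨ Eq.sym (ℕP.+-∸-assoc J (ℕP.<⇒≤ n<r)) ⟩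
      J ℕ.+ r ∸ n    ≡⟨ Eq.sym m≡ ⟩
      m              ≤⟨ m≤r ⟩
      r              ≡⟨ Eq.sym (ℕP.m+[n∸m]≡n (ℕP.<⇒≤ n<r)) ⟩
      n ℕ.+ (r ∸ n)  ∎)
      where open ℕP.≤-Reasoning

    YH-last : m ≤ r → ∀ rest x → Y.Hexpr J n (rest ∷ʳ suc x) A.≈ A.- signedA m (P.1# m (rest ∷ʳ x))
    YH-last m≤r rest x = A.-‿cong (A.trans (A.reflexive (ΣP-at m (suc n) term e))
      (A.trans (Sums.Σ<-single A (suc n) a₀ (s≤s (ℕP.m∸n≤m n J)) others) leading))
      where
      e = rest ∷ʳ suc x
      a₀ = n ∸ J
      n∸a₀≡J : n ∸ a₀ ≡ J
      n∸a₀≡J = ℕP.m∸[m∸n]≡n (J≤n m≤r)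
      r∸a₀≡m : r ∸ a₀ ≡ m
      r∸a₀≡m = Eq.trans (Eq.sym (ℕP.+-identityʳ (r ∸ a₀)))
        (Eq.trans (Eq.cong (λ t → (r ∸ a₀) ℕ.+ t) (Eq.sym (Eq.trans (Eq.cong (J ∸_) n∸a₀≡J) (ℕP.n∸n≡0 J))))
                  (term-degree′ a₀ (ℕP.m∸n≤m n J) (ℕP.≤-reflexive n∸a₀≡J)))
      leading : term a₀ e A.≈ signedA m (P.1# m (rest ∷ʳ x))
      leading = A.reflexive (begin
        term a₀ e                                                 ≡⟨ Eq.cong₂ (λ t u → Signs.signed (PolyRing m) t (mulVar (ℕ.pred t) (Y.G J u)) e) r∸a₀≡m n∸a₀≡J ⟩
        Signs.signed (PolyRing m) m (mulVar k (Y.G J J)) e        ≡⟨ Eq.cong (λ z → Signs.signed (PolyRing m) m (mulVar k z) e) (Y.G-last J) ⟩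
        Signs.signed (PolyRing m) m (mulVar k (P.1# m)) e         ≡⟨ signed-at m (mulVar k (P.1# m)) e ⟩
        signedA m (mulVar k (P.1# m) e)                           ≡⟨ Eq.cong (signedA m) (mulVar-last (P.1# m) rest x) ⟩
        signedA m (P.1# m (rest ∷ʳ x))                            ∎)
        where open Eq.≡-Reasoning
      others : ∀ a → a < suc n → ¬ a ≡ a₀ → term a e A.≈ A.0#
      others a (s≤s a≤n) a≢a₀ with ℕP.<-cmp (n ∸ a) J
      ... | tri< lt _ _ = noLast-signed (r ∸ a) (noLast-mulVar (ℕ.pred (r ∸ a)) pred<k (YG-noLast J (ℕP.≤-pred J<m) (n ∸ a))) rest x
        where
        r∸a<m : r ∸ a < m
        r∸a<m = Eq.subst (r ∸ a <_) (term-degree′ a a≤n (ℕP.<⇒≤ lt)) (ℕP.m<m+n (r ∸ a) (ℕP.m<n⇒0<n∸m lt))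
        pred<k : ℕ.pred (r ∸ a) < k
        pred<k = ℕP.<-≤-trans (ℕP.≤-reflexive (suc-pred (r ∸ a) (r∸a-positive a a≤n))) (ℕP.≤-pred r∸a<m)
      ... | tri≈ _ eq _ = ⊥-elim (a≢a₀ (Eq.trans (Eq.sym (ℕP.m∸[m∸n]≡n a≤n)) (Eq.cong (n ∸_) eq)))
      ... | tri> _ _ gt = A.trans (A.reflexive (signed-at (r ∸ a) _ e))
          (signedA-zero (r ∸ a) (mulVar-zero _ (λ e′ → A.reflexive (Eq.cong (λ z → z e′) (Y.G-beyond J (n ∸ a) gt))) e))

-- Lemma 2.3 over a finite field F (only its ring structure and 1 ≠ 0
-- are used).

module Lemma {c ℓ} (F : FiniteField c ℓ) (r : ℕ) where
  open Setting F r using (Fo; IsRemainderCoeffs; esymCoeff; Π; evalΠ) renaming (R to Rᵒ)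

  A : CommutativeRing c ℓ
  A = FiniteField.commRing F

  open Polynomials A
  open Vanishing A
  open ElementarySymmetric A using (esym)
  open Signs A using (signed; signed-cong; signed-*ˡ; signed-square)
  module R = CommutativeRing (PolyRing r)
  module const = IsRingHomomorphism (const-isRingHomomorphism r)

  esymCoeff≡esym : ∀ {n} l (e : Vec ℕ n) → esymCoeff l e ≡ esym l e
  esymCoeff≡esym zero    []                 = Eq.refl
  esymCoeff≡esym (suc l) []                 = Eq.refl
  esymCoeff≡esym zero    (zero ∷ es)        = esymCoeff≡esym zero es
  esymCoeff≡esym (suc l) (zero ∷ es)        = esymCoeff≡esym (suc l) es
  esymCoeff≡esym zero    (suc zero ∷ es)    = Eq.refl
  esymCoeff≡esym (suc l) (suc zero ∷ es)    = esymCoeff≡esym l es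
  esymCoeff≡esym zero    (suc (suc x) ∷ es) = Eq.refl
  esymCoeff≡esym (suc l) (suc (suc x) ∷ es) = Eq.refl

  -- the unit ∓1 relating H to the monic polynomial
  unit : ℕ → A.Carrier
  unit m = A.- signed m A.1#

  unit-square : ∀ m → unit m A.* unit m A.≈ A.1#
  unit-square m = A.trans (A.sym (AP.-‿distribˡ-* _ _))
    (A.trans (A.-‿cong (A.sym (AP.-‿distribʳ-* _ _))) (A.trans (AP.-‿involutive _) (signed-square m)))

  unit≉0 : ∀ m → ¬ unit m A.≈ A.0#
  unit≉0 m u≈0 = FiniteField.1≉0 F (A.trans (A.sym (unit-square m)) (A.trans (A.*-congʳ u≈0) (A.zeroˡ _)))

  Homogeneity : ℕ → (Fin r → R.Carrier) → Fin r → Set ℓ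
  Homogeneity j H i = (RingOps._≈_ Rᵒ (H i) (RingOps.0# Rᵒ)) ⊎ IsHomogeneous Fo (j ∸ toℕ i) (H i)

  MonicInΠ : ℕ → (Fin r → R.Carrier) → Fin r → Set (c ⊔ ℓ)
  MonicInΠ j H i = ∀ k → suc k ≡ j ∸ toℕ i → suc k ≤ r →
    Σ (RingOps.Carrier Fo) λ a → ¬ (RingOps._≈_ Fo a (RingOps.0# Fo))
      × Σ ℕ λ N → Σ (Vec ℕ (suc k) → RingOps.Carrier Fo) λ P →
          IsPolyBound Fo N P × IsMonicLast Fo P
          × RingOps._≈_ Rᵒ (H i) (RingOps._*_ Rᵒ (const Fo a) (evalΠ N P))

  module RemainderCoefficient (J : ℕ) (H : Fin r → R.Carrier) (S : Polynomials.Coeffs (PolyRing r) 1)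
           (div : Remainder.IsDivision A r (J ℕ.+ r) H S)
           (N : ℕ) (S-bounded : ∀ b → N < b → S (b ∷ []) R.≈ R.0#) (i : Fin r) where
    open Remainder A r using (Hexpr-homogeneous; module Quotient)
    open Quotient J H S div N S-bounded using (H≈Hexpr)

    n = toℕ i
    n<r = FinP.toℕ<n i

    homogeneous : IsHomogeneous Aᵒ (J ℕ.+ r ∸ n) (H i)
    homogeneous = vanishes-cong (λ e → A.sym (H≈Hexpr i e)) (Hexpr-homogeneous J n n<r)

    module Monic (k : ℕ) (m≡ : suc k ≡ J ℕ.+ r ∸ n) (m≤r : suc k ≤ r) where
      open InTermsOfΠ A r k (λ p → Π (suc p)) (λ p e → A.reflexive (esymCoeff≡esym (suc p) e))
        using (m; v; module Y; module Coefficient)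
      open Coefficient J n n<r m≡
      open Evaluation A (PolyRing r) (const Aᵒ) (const-isRingHomomorphism r)

      -- the monic polynomial: P = unit·Y.Hexpr J n = Y_m + (terms in Y₁,…,Y_{m-1})
      P : Coeffs (suc k)
      P = scale (unit m) (Y.Hexpr J n)

      P-monic : IsMonicLast Aᵒ P
      P-monic = monic-linear P (λ rest x → A.trans (A.*-congˡ (YH-last m≤r rest x)) (linear (P.1# m (rest ∷ʳ x))))
        where
        -- unit·(-(-1)ᵐ·y) = unit·unit·y = y
        linear : ∀ y → unit m A.* A.- signed m y A.≈ y
        linear y = A.trans (A.*-congˡ (A.-‿cong (A.trans (signed-cong m (A.sym (A.*-identityˡ y))) (signed-*ˡ m A.1# y))))
          (A.trans (A.*-congˡ (AP.-‿distribˡ-* _ _)) (A.trans (A.sym (A.*-assoc _ _ _)) (A.trans (A.*-congʳ (unit-square m)) (A.*-identityˡ y))))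

      P-bounded : IsPolyBound Aᵒ m P
      P-bounded = vanishes-scale (unit m) YH-bounded

      H≈unit·P[Π] : H i R.≈ const Aᵒ (unit m) R.* evalΠ m P
      H≈unit·P[Π] = R.sym (begin
        const Aᵒ (unit m) R.* evalΠ m P                              ≡⟨ Eq.cong (const Aᵒ (unit m) R.*_) (evaluate≡eval m P v) ⟩
        const Aᵒ (unit m) R.* evaluate m P v                         ≈⟨ R.*-congˡ (evaluate-scale m v (unit m) _) ⟩
        const Aᵒ (unit m) R.* (const Aᵒ (unit m) R.* evaluate m (Y.Hexpr J n) v)
                                                                     ≈⟨ R.*-congˡ (R.*-congˡ (R.trans YH-evaluates (R.sym (H≈Hexpr i)))) ⟩
        const Aᵒ (unit m) R.* (const Aᵒ (unit m) R.* H i)            ≈⟨ R.sym (R.*-assoc _ _ _) ⟩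
        (const Aᵒ (unit m) R.* const Aᵒ (unit m)) R.* H i            ≈⟨ R.*-congʳ (R.sym (const.*-homo _ _)) ⟩
        const Aᵒ (unit m A.* unit m) R.* H i                         ≈⟨ R.*-congʳ (R.trans (const.⟦⟧-cong (unit-square m)) const.1#-homo) ⟩
        R.1# R.* H i                                                 ≈⟨ R.*-identityˡ _ ⟩
        H i                                                          ∎)
        where open SetoidReasoning R.setoid

  remainder-coefficients : ∀ J H → IsRemainderCoeffs (J ℕ.+ r) H → ∀ i →
    Homogeneity (J ℕ.+ r) H i × MonicInΠ (J ℕ.+ r) H i
  remainder-coefficients J H (_ , S , ((N , S-bounded) , _) , div) i = inj₂ homogeneous , monic
    where
    bounded : ∀ b → N < b → S (b ∷ []) R.≈ R.0#
    bounded b N<b = S-bounded (b ∷ []) (Eq.subst (N <_) (Eq.sym (ℕP.+-identityʳ b)) N<b)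
    open RemainderCoefficient J H S div N bounded i
    monic : MonicInΠ (J ℕ.+ r) H i
    monic k m≡ m≤r = unit (suc k) , unit≉0 (suc k) , suc k , P , P-bounded , P-monic , H≈unit·P[Π]
      where open Monic k m≡ m≤r

lemma2p3 : ∀ {c ℓ} (F : FiniteField c ℓ) (r d : ℕ) → 1 ≤ r → r ≤ d →
    let open Setting F r in
    ∀ j → r ≤ j → j ≤ d →
    (H : Fin r → RingOps.Carrier R) → IsRemainderCoeffs j H →
    ∀ i →
      ((RingOps._≈_ R (H i) (RingOps.0# R)) ⊎ IsHomogeneous Fo (j ∸ toℕ i) (H i))
      × (∀ k → suc k ≡ j ∸ toℕ i → suc k ≤ r →
           Σ (RingOps.Carrier Fo) λ a → ¬ (RingOps._≈_ Fo a (RingOps.0# Fo))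
             × Σ ℕ λ N → Σ (Vec ℕ (suc k) → RingOps.Carrier Fo) λ P →
                 IsPolyBound Fo N P × IsMonicLast Fo P
                 × RingOps._≈_ R (H i) (RingOps._*_ R (const Fo a) (evalΠ N P)))
lemma2p3 F r d _ _ j r≤j _ H remainder i with j ∸ r | ℕP.m∸n+n≡m r≤j
... | J | Eq.refl = Lemma.remainder-coefficients F r J H remainder i
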